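{- For any explicit primitive recursive function $\tau$ (not containing $z$), $\mathbf{CLA7}\vdash \sqcup z\,(z=\tau)$.
   Context: A primitive recursive construction of a function $f$ is a sequence of definitions $E_1,\ldots,E_k$ of distinct functions $g_1,\ldots,g_k=f$, each either absolute ($\forall x(g(x)=x')$; $\forall\vec x(g(\vec x)=0)$; $\forall\vec x(g(x_1,\ldots,x_n)=x_i)$) or relative to earlier $g_j$ by composition ($g(\vec x)=h(h_1(\vec x),\ldots,h_m(\vec x))$) or primitive recursion ($g(0,\vec x)=h(\vec x)$, $g(x_1',\vec x)=h'(x_1,g(x_1,\vec x),\vec x)$). An explicit primitive recursive function is a primitive recursive construction of a unary function. "$z=\tau$" abbreviates a standard formula of the language of Peano arithmetic (one from which PA proves the defining equations of the construction) saying that $z$ equals the value of $\tau$ at its argument $x$. $\mathbf{CLA7}$ is the theory in the language of Peano arithmetic extended with computability-logic choice operators $\sqcap,\sqcup$ and choice quantifiers $\sqcap x,\sqcup x$, with axioms the Peano axioms plus $\sqcap x\sqcup y(y=x')$, logical rule LC (logical consequence in logic $\mathbf{CL12}$), and the induction rule: from $\sqcap(F(0))$ and $\sqcap(F(x)\to F(x'))$ infer $\sqcap(F(x))$ ($\sqcap$-closures) for arbitrary formulas $F(x)$. A formula with free variables is provable when its $\sqcap$-closure is. -}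

module Defs where

open import Data.Nat using (ℕ; zero; suc; _+_)
open import Data.Fin using (Fin; zero; suc; _↑ˡ_; _↑ʳ_)
open import Data.List using (List; []; _∷_; map; _++_; foldr)
open import Data.List.Membership.Propositional using (_∈_)
open import Data.List.Relation.Unary.All as All using (All; []; _∷_)
open import Data.Vec as Vec using (Vec)
open import Data.Product using (Σ; _×_; _,_)
open import Data.Unit using (⊤)

-- Syntax of the language of PA extended with choice operators
-- (negation normal form; well-scoped de Bruijn indices, var zero is the
-- innermost bound / most recently introduced variable)

data Term (n : ℕ) : Set where
  var  : Fin n → Term n
  `0   : Term n
  S    : Term n → Term n
  _⊕_  : Term n → Term n → Term n
  _⊗_  : Term n → Term n → Term n

infix  6 _≐_ _≠_
infixr 5 _∧_ _⊓_
infixr 4 _∨_ _⊔_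

data Formula (n : ℕ) : Set where
  _≐_ _≠_          : Term n → Term n → Formula n
  ⊤ᶠ ⊥ᶠ            : Formula n
  _∧_ _∨_          : Formula n → Formula n → Formula n
  _⊓_ _⊔_          : Formula n → Formula n → Formula n
  Πᶠ Σᶠ            : Formula (suc n) → Formula n        -- blind ∀ , ∃
  ⊓ᶠ ⊔ᶠ            : Formula (suc n) → Formula n

extR : ∀ {m n} → (Fin m → Fin n) → Fin (suc m) → Fin (suc n)
extR ρ zero    = zero
extR ρ (suc i) = suc (ρ i)

renT : ∀ {m n} → (Fin m → Fin n) → Term m → Term n
renT ρ (var i) = var (ρ i)
renT ρ `0      = `0
renT ρ (S t)   = S (renT ρ t)
renT ρ (t ⊕ u) = renT ρ t ⊕ renT ρ u
renT ρ (t ⊗ u) = renT ρ t ⊗ renT ρ u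

ren : ∀ {m n} → (Fin m → Fin n) → Formula m → Formula n
ren ρ (t ≐ u) = renT ρ t ≐ renT ρ u
ren ρ (t ≠ u) = renT ρ t ≠ renT ρ u
ren ρ ⊤ᶠ      = ⊤ᶠ
ren ρ ⊥ᶠ      = ⊥ᶠ
ren ρ (A ∧ B) = ren ρ A ∧ ren ρ B
ren ρ (A ∨ B) = ren ρ A ∨ ren ρ B
ren ρ (A ⊓ B) = ren ρ A ⊓ ren ρ B
ren ρ (A ⊔ B) = ren ρ A ⊔ ren ρ B
ren ρ (Πᶠ A)  = Πᶠ (ren (extR ρ) A)
ren ρ (Σᶠ A)  = Σᶠ (ren (extR ρ) A)
ren ρ (⊓ᶠ A)  = ⊓ᶠ (ren (extR ρ) A)
ren ρ (⊔ᶠ A)  = ⊔ᶠ (ren (extR ρ) A)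

extS : ∀ {m n} → (Fin m → Term n) → Fin (suc m) → Term (suc n)
extS σ zero    = var zero
extS σ (suc i) = renT suc (σ i)

subT : ∀ {m n} → (Fin m → Term n) → Term m → Term n
subT σ (var i) = σ i
subT σ `0      = `0
subT σ (S t)   = S (subT σ t)
subT σ (t ⊕ u) = subT σ t ⊕ subT σ u
subT σ (t ⊗ u) = subT σ t ⊗ subT σ u

sub : ∀ {m n} → (Fin m → Term n) → Formula m → Formula n
sub σ (t ≐ u) = subT σ t ≐ subT σ u
sub σ (t ≠ u) = subT σ t ≠ subT σ u
sub σ ⊤ᶠ      = ⊤ᶠ
sub σ ⊥ᶠ      = ⊥ᶠ
sub σ (A ∧ B) = sub σ A ∧ sub σ B
sub σ (A ∨ B) = sub σ A ∨ sub σ B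
sub σ (A ⊓ B) = sub σ A ⊓ sub σ B
sub σ (A ⊔ B) = sub σ A ⊔ sub σ B
sub σ (Πᶠ A)  = Πᶠ (sub (extS σ) A)
sub σ (Σᶠ A)  = Σᶠ (sub (extS σ) A)
sub σ (⊓ᶠ A)  = ⊓ᶠ (sub (extS σ) A)
sub σ (⊔ᶠ A)  = ⊔ᶠ (sub (extS σ) A)

wk : ∀ {n} → Formula n → Formula (suc n)
wk = ren suc

closedTo : ∀ {n} → Formula 0 → Formula n
closedTo = ren (λ ())

_[_]₀ : ∀ {n} → Formula (suc n) → Term n → Formula n
A [ t ]₀ = sub (λ { zero → t ; (suc i) → var i }) A

atSucc : ∀ {n} → Formula (suc n) → Formula (suc n)
atSucc = sub (λ { zero → S (var zero) ; (suc i) → var (suc i) })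

swap01 : ∀ {n} → Fin (suc (suc n)) → Fin (suc (suc n))
swap01 zero          = suc zero
swap01 (suc zero)    = zero
swap01 (suc (suc i)) = suc (suc i)

neg : ∀ {n} → Formula n → Formula n
neg (t ≐ u) = t ≠ u
neg (t ≠ u) = t ≐ u
neg ⊤ᶠ      = ⊥ᶠ
neg ⊥ᶠ      = ⊤ᶠ
neg (A ∧ B) = neg A ∨ neg B
neg (A ∨ B) = neg A ∧ neg B
neg (A ⊓ B) = neg A ⊔ neg B
neg (A ⊔ B) = neg A ⊓ neg B
neg (Πᶠ A)  = Σᶠ (neg A)
neg (Σᶠ A)  = Πᶠ (neg A)
neg (⊓ᶠ A)  = ⊔ᶠ (neg A)
neg (⊔ᶠ A)  = ⊓ᶠ (neg A)

infixr 3 _⇒_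
infix  3 _⇔_
_⇒_ : ∀ {n} → Formula n → Formula n → Formula n
A ⇒ B = neg A ∨ B

_⇔_ : ∀ {n} → Formula n → Formula n → Formula n
A ⇔ B = (A ⇒ B) ∧ (B ⇒ A)

∀cl : ∀ {n} → Formula n → Formula 0
∀cl {zero}  A = A
∀cl {suc n} A = ∀cl (Πᶠ A)

⊓cl : ∀ {n} → Formula n → Formula 0
⊓cl {zero}  A = A
⊓cl {suc n} A = ⊓cl (⊓ᶠ A)

data Elem {n : ℕ} : Formula n → Set where
  eq  : ∀ {t u} → Elem (t ≐ u)
  neq : ∀ {t u} → Elem (t ≠ u)
  top : Elem ⊤ᶠ
  bot : Elem ⊥ᶠ
  and : ∀ {A B} → Elem A → Elem B → Elem (A ∧ B)
  or  : ∀ {A B} → Elem A → Elem B → Elem (A ∨ B)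
  all : ∀ {A} → Elem A → Elem (Πᶠ A)
  ex  : ∀ {A} → Elem A → Elem (Σᶠ A)

-- Classical first-order logic with identity: a cut-free one-sided
-- (Tait/G3-style) sequent calculus, complete for classical validity.

data ⊢T_ : ∀ {n} → List (Formula n) → Set where
  ax   : ∀ {n} {Γ : List (Formula n)} {t u} → (t ≐ u) ∈ Γ → (t ≠ u) ∈ Γ → ⊢T Γ
  top  : ∀ {n} {Γ : List (Formula n)} → ⊤ᶠ ∈ Γ → ⊢T Γ
  and  : ∀ {n} {Γ : List (Formula n)} {A B} → (A ∧ B) ∈ Γ →
         ⊢T (A ∷ Γ) → ⊢T (B ∷ Γ) → ⊢T Γ
  or   : ∀ {n} {Γ : List (Formula n)} {A B} → (A ∨ B) ∈ Γ →
         ⊢T (A ∷ B ∷ Γ) → ⊢T Γ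
  all  : ∀ {n} {Γ : List (Formula n)} {A} → Πᶠ A ∈ Γ →
         ⊢T (A ∷ map wk Γ) → ⊢T Γ
  ex   : ∀ {n} {Γ : List (Formula n)} {A} → Σᶠ A ∈ Γ → (t : Term n) →
         ⊢T ((A [ t ]₀) ∷ Γ) → ⊢T Γ

private
  v0 v1 v2 v3 : ∀ {n} → Term (suc (suc (suc (suc n))))
  v0 = var zero
  v1 = var (suc zero)
  v2 = var (suc (suc zero))
  v3 = var (suc (suc (suc zero)))

EqAxioms : List (Formula 0)
EqAxioms =
    Πᶠ (var zero ≐ var zero)
  ∷ Πᶠ (Πᶠ (var (suc zero) ≐ var zero ⇒ S (var (suc zero)) ≐ S (var zero)))
  ∷ ∀cl {4} (v3 ≐ v2 ∧ v1 ≐ v0 ⇒ v3 ⊕ v1 ≐ v2 ⊕ v0)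
  ∷ ∀cl {4} (v3 ≐ v2 ∧ v1 ≐ v0 ⇒ v3 ⊗ v1 ≐ v2 ⊗ v0)
  ∷ ∀cl {4} (v3 ≐ v2 ∧ v1 ≐ v0 ⇒ (v3 ≐ v1 ⇒ v2 ≐ v0))
  ∷ []

Valid : ∀ {n} → List (Formula n) → Set
Valid Γ = ⊢T (Γ ++ map (λ A → neg (closedTo A)) EqAxioms)

data PAAx : Formula 0 → Set where
  pa1 : PAAx (Πᶠ (`0 ≠ S (var zero)))
  pa2 : PAAx (Πᶠ (Πᶠ (S (var (suc zero)) ≐ S (var zero) ⇒ var (suc zero) ≐ var zero)))
  pa3 : PAAx (Πᶠ (var zero ⊕ `0 ≐ var zero))
  pa4 : PAAx (Πᶠ (Πᶠ (var (suc zero) ⊕ S (var zero) ≐ S (var (suc zero) ⊕ var zero))))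
  pa5 : PAAx (Πᶠ (var zero ⊗ `0 ≐ `0))
  pa6 : PAAx (Πᶠ (Πᶠ (var (suc zero) ⊗ S (var zero) ≐ (var (suc zero) ⊗ var zero) ⊕ var (suc zero))))
  pa7 : ∀ {n} (F : Formula (suc n)) → Elem F →
        PAAx (∀cl ((F [ `0 ]₀) ∧ Πᶠ (F ⇒ atSucc F) ⇒ Πᶠ F))

PA⊢_ : Formula 0 → Set
PA⊢ φ = Σ (List (Formula 0)) λ As → All PAAx As × Valid (φ ∷ map neg As)

data Kind : Set where
  sqcap sqcup : Kind

bin : ∀ {n} → Kind → Formula n → Formula n → Formula n
bin sqcap A B = A ⊓ B
bin sqcup A B = A ⊔ B

qch : ∀ {n} → Kind → Formula (suc n) → Formula n
qch sqcap A = ⊓ᶠ A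
qch sqcup A = ⊔ᶠ A

‖_‖ : ∀ {n} → Formula n → Formula n
‖ t ≐ u ‖ = t ≐ u
‖ t ≠ u ‖ = t ≠ u
‖ ⊤ᶠ ‖    = ⊤ᶠ
‖ ⊥ᶠ ‖    = ⊥ᶠ
‖ A ∧ B ‖ = ‖ A ‖ ∧ ‖ B ‖
‖ A ∨ B ‖ = ‖ A ‖ ∨ ‖ B ‖
‖ A ⊓ B ‖ = ⊤ᶠ
‖ A ⊔ B ‖ = ⊥ᶠ
‖ Πᶠ A ‖  = Πᶠ ‖ A ‖
‖ Σᶠ A ‖  = Σᶠ ‖ A ‖
‖ ⊓ᶠ A ‖  = ⊤ᶠ
‖ ⊔ᶠ A ‖  = ⊥ᶠ

Stable : ∀ {n} → List (Formula n) → Formula n → Set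
Stable Y F = Valid (‖ F ‖ ∷ map (λ E → neg ‖ E ‖) Y)

data Bin {n : ℕ} (k : Kind) : Formula n → Formula n → Set where
  pick₀ : ∀ {A B} → Bin k (bin k A B) A
  pick₁ : ∀ {A B} → Bin k (bin k A B) B
  ∧ˡ : ∀ {A A' B} → Bin k A A' → Bin k (A ∧ B) (A' ∧ B)
  ∧ʳ : ∀ {A B B'} → Bin k B B' → Bin k (A ∧ B) (A ∧ B')
  ∨ˡ : ∀ {A A' B} → Bin k A A' → Bin k (A ∨ B) (A' ∨ B)
  ∨ʳ : ∀ {A B B'} → Bin k B B' → Bin k (A ∨ B) (A ∨ B')
  Πc : ∀ {A A'} → Bin k A A' → Bin k (Πᶠ A) (Πᶠ A')
  Σc : ∀ {A A'} → Bin k A A' → Bin k (Σᶠ A) (Σᶠ A')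

-- replace one surface occurrence of a choice quantification Qx G(x) by G(y),
-- y a fresh variable (the new var zero of the extended context)
data Fresh (k : Kind) : ∀ {n} → Formula n → Formula (suc n) → Set where
  base : ∀ {n} {A : Formula (suc n)} → Fresh k (qch k A) A
  ∧ˡ : ∀ {n} {A B : Formula n} {A'} → Fresh k A A' → Fresh k (A ∧ B) (A' ∧ wk B)
  ∧ʳ : ∀ {n} {A B : Formula n} {B'} → Fresh k B B' → Fresh k (A ∧ B) (wk A ∧ B')
  ∨ˡ : ∀ {n} {A B : Formula n} {A'} → Fresh k A A' → Fresh k (A ∨ B) (A' ∨ wk B)
  ∨ʳ : ∀ {n} {A B : Formula n} {B'} → Fresh k B B' → Fresh k (A ∨ B) (wk A ∨ B')
  Πc : ∀ {n} {A : Formula (suc n)} {A'} → Fresh k A A' → Fresh k (Πᶠ A) (Πᶠ (ren swap01 A'))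
  Σc : ∀ {n} {A : Formula (suc n)} {A'} → Fresh k A A' → Fresh k (Σᶠ A) (Σᶠ (ren swap01 A'))

data Inst (k : Kind) : ∀ {n} → Term n → Formula n → Formula n → Set where
  base : ∀ {n} {t : Term n} {A} → Inst k t (qch k A) (A [ t ]₀)
  ∧ˡ : ∀ {n} {t : Term n} {A A' B} → Inst k t A A' → Inst k t (A ∧ B) (A' ∧ B)
  ∧ʳ : ∀ {n} {t : Term n} {A B B'} → Inst k t B B' → Inst k t (A ∧ B) (A ∧ B')
  ∨ˡ : ∀ {n} {t : Term n} {A A' B} → Inst k t A A' → Inst k t (A ∨ B) (A' ∨ B)
  ∨ʳ : ∀ {n} {t : Term n} {A B B'} → Inst k t B B' → Inst k t (A ∨ B) (A ∨ B')
  Πc : ∀ {n} {t : Term n} {A A'} → Inst k (renT suc t) A A' → Inst k t (Πᶠ A) (Πᶠ A')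
  Σc : ∀ {n} {t : Term n} {A A'} → Inst k (renT suc t) A A' → Inst k t (Σᶠ A) (Σᶠ A')

data Choosable {n : ℕ} : Term n → Set where
  isVar  : ∀ i → Choosable (var i)
  isZero : Choosable `0

data OneL {A : Set} (R : A → A → Set) : List A → List A → Set where
  here  : ∀ {x y xs} → R x y → OneL R (x ∷ xs) (y ∷ xs)
  there : ∀ {x xs ys} → OneL R xs ys → OneL R (x ∷ xs) (x ∷ ys)

data OneFresh (k : Kind) {n : ℕ} : List (Formula n) → List (Formula (suc n)) → Set where
  here  : ∀ {x y xs} → Fresh k x y → OneFresh k (x ∷ xs) (y ∷ map wk xs)
  there : ∀ {x xs ys} → OneFresh k xs ys → OneFresh k (x ∷ xs) (wk x ∷ ys)

data WaitN {n : ℕ} (Y : List (Formula n)) (F : Formula n) :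
           List (Formula n) → Formula n → Set where
  right : ∀ {F'} → Bin sqcap F F' → WaitN Y F Y F'
  left  : ∀ {Y'} → OneL (Bin sqcup) Y Y' → WaitN Y F Y' F

data WaitQ {n : ℕ} (Y : List (Formula n)) (F : Formula n) :
           List (Formula (suc n)) → Formula (suc n) → Set where
  right : ∀ {F'} → Fresh sqcap F F' → WaitQ Y F (map wk Y) F'
  left  : ∀ {Y'} → OneFresh sqcup Y Y' → WaitQ Y F Y' (wk F)

data ChooseS {n : ℕ} (Y : List (Formula n)) (F : Formula n) :
             List (Formula n) → Formula n → Set where
  right  : ∀ {F'} → Bin sqcup F F' → ChooseS Y F Y F'
  left   : ∀ {Y'} → OneL (Bin sqcap) Y Y' → ChooseS Y F Y' F
  rightQ : ∀ {t F'} → Choosable t → Inst sqcup t F F' → ChooseS Y F Y F'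
  leftQ  : ∀ {t Y'} → Choosable t → OneL (Inst sqcap t) Y Y' → ChooseS Y F Y' F

infix 2 _◦–_
data _◦–_ : ∀ {n} → List (Formula n) → Formula n → Set where
  wait      : ∀ {n} {Y : List (Formula n)} {F} → Stable Y F →
              (∀ {Y' F'} → WaitN Y F Y' F' → Y' ◦– F') →
              (∀ {Y' F'} → WaitQ Y F Y' F' → Y' ◦– F') →
              Y ◦– F
  choose    : ∀ {n} {Y Y' : List (Formula n)} {F F'} → ChooseS Y F Y' F' →
              Y' ◦– F' → Y ◦– F
  replicate : ∀ {n} {Y : List (Formula n)} {E F} → E ∈ Y →
              (Y ++ E ∷ []) ◦– F → Y ◦– F

-- The theory CLA7 (theorems are closed; an open formula is provable
-- iff its ⊓-closure is)

successorAxiom : Formula 0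
successorAxiom = ⊓ᶠ (⊔ᶠ (var zero ≐ S (var (suc zero))))

data CLA7⊢ : Formula 0 → Set where
  peano : ∀ {A} → PAAx A → CLA7⊢ A
  succA : CLA7⊢ successorAxiom
  LC    : ∀ {n} (Es : List (Formula n)) (F : Formula n) →
          (∀ {E} → E ∈ Es → CLA7⊢ (⊓cl E)) → Es ◦– F → CLA7⊢ (⊓cl F)
  ind   : ∀ {n} (F : Formula (suc n)) →
          CLA7⊢ (⊓cl (F [ `0 ]₀)) → CLA7⊢ (⊓cl (F ⇒ atSucc F)) → CLA7⊢ (⊓cl F)

-- A construction is indexed by the
-- list of arities of the functions defined so far (most recent first);
-- references to earlier functions are membership proofs.

data Def (as : List ℕ) : ℕ → Set where
  succ : Def as 1
  zer  : (n : ℕ) → Def as n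
  proj : (n : ℕ) → Fin n → Def as n
  comp : ∀ {m n} → m ∈ as → Vec (n ∈ as) m → Def as n
  prec : ∀ {n} → n ∈ as → suc (suc n) ∈ as → Def as (suc n)

data Constr : List ℕ → Set where
  []  : Constr []
  _▷_ : ∀ {as a} → Constr as → Def as a → Constr (a ∷ as)

-- a formula for an a-ary function g: free variables var zero = z (value),
-- var (suc i) = x_(i+1) (arguments)
Rep : ℕ → Set
Rep a = Formula (suc a)

app : ∀ {a n} → Rep a → (Fin a → Term n) → Term n → Formula n
app φ xs z = sub (λ { zero → z ; (suc i) → xs i }) φ

conj : ∀ {n} → List (Formula n) → Formula n
conj = foldr _∧_ ⊤ᶠ

DefEqs : ∀ {as a} → Def as a → Rep a → All Rep as → List (Formula 0)
DefEqs succ φ φs =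
  ∀cl {2} (app φ (λ _ → var (suc zero)) (var zero) ⇔ var zero ≐ S (var (suc zero))) ∷ []
DefEqs (zer n) φ φs =
  ∀cl (app φ (λ i → var (suc i)) (var zero) ⇔ var zero ≐ `0) ∷ []
DefEqs (proj n i) φ φs =
  ∀cl (app φ (λ j → var (suc j)) (var zero) ⇔ var zero ≐ var (suc i)) ∷ []
DefEqs (comp {m} {n} h hs) φ φs =
    -- variables: z = var zero, y_j = var (suc (j ↑ˡ n)), x_i = var (suc (m ↑ʳ i))
    ∀cl (conj (Data.List.map (λ j → app (All.lookup φs (Vec.lookup hs j)) X (Y j)) (allFin' m))
         ⇒ (app φ X (var zero) ⇔ app (All.lookup φs h) Y (var zero)))
  ∷ []
  where
    X : Fin n → Term (suc (m + n))
    X i = var (suc (m ↑ʳ i))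
    Y : Fin m → Term (suc (m + n))
    Y j = var (suc (j ↑ˡ n))
    allFin' : (k : ℕ) → List (Fin k)
    allFin' k = Data.List.tabulate {n = k} (λ j → j)
DefEqs (prec {n} h h') φ φs =
    -- g(0, x⃗) = h(x⃗);  variables z = var zero, x_i = var (suc i)
    ∀cl (app φ (λ { zero → `0 ; (suc i) → var (suc i) }) (var zero)
         ⇔ app (All.lookup φs h) (λ i → var (suc i)) (var zero))
    -- g(x1', x⃗) = h'(x1, g(x1, x⃗), x⃗);
    -- variables z = var 0, y = var 1 (value of g(x1,x⃗)), x1 = var 2, x_i = var (3+i)
  ∷ ∀cl (app φ (λ { zero → X1 ; (suc i) → X i }) Yv
         ⇒ (app φ (λ { zero → S X1 ; (suc i) → X i }) (var zero)
            ⇔ app (All.lookup φs h') (λ { zero → X1 ; (suc zero) → Yv ; (suc (suc i)) → X i }) (var zero)))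
  ∷ []
  where
    Yv X1 : Term (suc (suc (suc n)))
    Yv = var (suc zero)
    X1 = var (suc (suc zero))
    X : Fin n → Term (suc (suc (suc n)))
    X i = var (suc (suc (suc i)))

Functional : ∀ {a} → Rep a → List (Formula 0)
Functional {a} φ =
    ∀cl {a} (Σᶠ φ)
  ∷ ∀cl {suc (suc a)} (app φ X (var (suc zero)) ∧ app φ X (var zero) ⇒ var (suc zero) ≐ var zero)
  ∷ []
  where
    X : Fin a → Term (suc (suc a))
    X i = var (suc (suc i))

Standard : ∀ {as} → Constr as → All Rep as → Set
Standard [] [] = ⊤
Standard (c ▷ d) (φ ∷ φs) =
  Standard c φs × Elem φ × All PA⊢_ (Functional φ) × All PA⊢_ (DefEqs d φ φs)

module Submission where

-- By induction along the construction, every formula φ(z, x⃗) of a standard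
-- construction is elementary with CLA7 ⊢ ⊓x⃗ ⊔z φ.  The CL12 strategies: for 0
-- and projections, name z directly; for the successor, query the axiom
-- ⊓x ⊔y (y = x') and copy its answer; for a composition, query the inner
-- functions at x⃗, feed their answers to the outer one and copy its answer; for
-- primitive recursion, use CLA7 induction on the first argument, the base
-- querying h and the step querying h' at the previous value.  Each final move is
-- justified by a classically valid elementary sequent whose premise is a
-- defining equation, provable in PA and hence in CLA7.

open import Defs
open import Data.Nat using (ℕ; suc)
open import Data.List using (List; _∷_)
open import Data.List.Relation.Unary.All using (All; _∷_; head)

open import Data.Nat using (zero; _+_)
open import Data.Fin using (Fin; zero; suc; _↑ˡ_; _↑ʳ_; splitAt)
open import Data.Fin.Properties using (splitAt-↑ˡ; splitAt-↑ʳ)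
open import Data.Vec.Functional using () renaming (_∷_ to _∷ᵛ_)
import Data.Vec as Vec
open import Data.List using ([]; map; _++_; allFin; tabulate)
open import Data.List.Properties using (map-∘; map-id; map-++; ++-assoc)
open import Data.List.Relation.Unary.All as All using ([])
open import Data.List.Relation.Unary.All.Properties using (map⁺; ++⁺; tabulate⁺)
open import Data.List.Relation.Unary.Any using (here; there)
open import Data.List.Membership.Propositional using (_∈_)
open import Data.List.Membership.Propositional.Properties
  using (∈-map⁺; ∈-map⁻; ∈-++⁺ˡ; ∈-++⁺ʳ; ∈-++⁻; ∈-allFin)
open import Data.List.Relation.Binary.Subset.Propositional using (_⊆_)
open import Data.List.Relation.Binary.Subset.Propositional.Properties
  using (∷⁺ʳ) renaming (map⁺ to map-⊆)
open import Data.Product using (Σ; _,_; proj₁; proj₂)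
open import Data.Sum using (_⊎_; inj₁; inj₂; [_,_]′)
open import Data.Empty using (⊥; ⊥-elim)
open import Function using (_∘_; id)
open import Relation.Binary.PropositionalEquality

extR-cong : ∀ {m n} {ρ ρ' : Fin m → Fin n} → ρ ≗ ρ' → extR ρ ≗ extR ρ'
extR-cong e zero    = refl
extR-cong e (suc i) = cong suc (e i)

renT-cong : ∀ {m n} {ρ ρ' : Fin m → Fin n} → ρ ≗ ρ' → ∀ t → renT ρ t ≡ renT ρ' t
renT-cong e (var i) = cong var (e i)
renT-cong e `0      = refl
renT-cong e (S t)   = cong S (renT-cong e t)
renT-cong e (t ⊕ u) = cong₂ _⊕_ (renT-cong e t) (renT-cong e u)
renT-cong e (t ⊗ u) = cong₂ _⊗_ (renT-cong e t) (renT-cong e u)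

ren-cong : ∀ {m n} {ρ ρ' : Fin m → Fin n} → ρ ≗ ρ' → ∀ A → ren ρ A ≡ ren ρ' A
ren-cong e (t ≐ u) = cong₂ _≐_ (renT-cong e t) (renT-cong e u)
ren-cong e (t ≠ u) = cong₂ _≠_ (renT-cong e t) (renT-cong e u)
ren-cong e ⊤ᶠ      = refl
ren-cong e ⊥ᶠ      = refl
ren-cong e (A ∧ B) = cong₂ _∧_ (ren-cong e A) (ren-cong e B)
ren-cong e (A ∨ B) = cong₂ _∨_ (ren-cong e A) (ren-cong e B)
ren-cong e (A ⊓ B) = cong₂ _⊓_ (ren-cong e A) (ren-cong e B)
ren-cong e (A ⊔ B) = cong₂ _⊔_ (ren-cong e A) (ren-cong e B)
ren-cong e (Πᶠ A)  = cong Πᶠ (ren-cong (extR-cong e) A)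
ren-cong e (Σᶠ A)  = cong Σᶠ (ren-cong (extR-cong e) A)
ren-cong e (⊓ᶠ A)  = cong ⊓ᶠ (ren-cong (extR-cong e) A)
ren-cong e (⊔ᶠ A)  = cong ⊔ᶠ (ren-cong (extR-cong e) A)

extS-cong : ∀ {m n} {σ σ' : Fin m → Term n} → σ ≗ σ' → extS σ ≗ extS σ'
extS-cong e zero    = refl
extS-cong e (suc i) = cong (renT suc) (e i)

subT-cong : ∀ {m n} {σ σ' : Fin m → Term n} → σ ≗ σ' → ∀ t → subT σ t ≡ subT σ' t
subT-cong e (var i) = e i
subT-cong e `0      = refl
subT-cong e (S t)   = cong S (subT-cong e t)
subT-cong e (t ⊕ u) = cong₂ _⊕_ (subT-cong e t) (subT-cong e u)
subT-cong e (t ⊗ u) = cong₂ _⊗_ (subT-cong e t) (subT-cong e u)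

sub-cong : ∀ {m n} {σ σ' : Fin m → Term n} → σ ≗ σ' → ∀ A → sub σ A ≡ sub σ' A
sub-cong e (t ≐ u) = cong₂ _≐_ (subT-cong e t) (subT-cong e u)
sub-cong e (t ≠ u) = cong₂ _≠_ (subT-cong e t) (subT-cong e u)
sub-cong e ⊤ᶠ      = refl
sub-cong e ⊥ᶠ      = refl
sub-cong e (A ∧ B) = cong₂ _∧_ (sub-cong e A) (sub-cong e B)
sub-cong e (A ∨ B) = cong₂ _∨_ (sub-cong e A) (sub-cong e B)
sub-cong e (A ⊓ B) = cong₂ _⊓_ (sub-cong e A) (sub-cong e B)
sub-cong e (A ⊔ B) = cong₂ _⊔_ (sub-cong e A) (sub-cong e B)
sub-cong e (Πᶠ A)  = cong Πᶠ (sub-cong (extS-cong e) A)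
sub-cong e (Σᶠ A)  = cong Σᶠ (sub-cong (extS-cong e) A)
sub-cong e (⊓ᶠ A)  = cong ⊓ᶠ (sub-cong (extS-cong e) A)
sub-cong e (⊔ᶠ A)  = cong ⊔ᶠ (sub-cong (extS-cong e) A)

renT-as-subT : ∀ {m n} (ρ : Fin m → Fin n) t → renT ρ t ≡ subT (var ∘ ρ) t
renT-as-subT ρ (var i) = refl
renT-as-subT ρ `0      = refl
renT-as-subT ρ (S t)   = cong S (renT-as-subT ρ t)
renT-as-subT ρ (t ⊕ u) = cong₂ _⊕_ (renT-as-subT ρ t) (renT-as-subT ρ u)
renT-as-subT ρ (t ⊗ u) = cong₂ _⊗_ (renT-as-subT ρ t) (renT-as-subT ρ u)

extR-as-extS : ∀ {m n} (ρ : Fin m → Fin n) → var ∘ extR ρ ≗ extS (var ∘ ρ)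
extR-as-extS ρ zero    = refl
extR-as-extS ρ (suc i) = refl

ren-as-sub : ∀ {m n} (ρ : Fin m → Fin n) A → ren ρ A ≡ sub (var ∘ ρ) A
ren-as-sub ρ (t ≐ u) = cong₂ _≐_ (renT-as-subT ρ t) (renT-as-subT ρ u)
ren-as-sub ρ (t ≠ u) = cong₂ _≠_ (renT-as-subT ρ t) (renT-as-subT ρ u)
ren-as-sub ρ ⊤ᶠ      = refl
ren-as-sub ρ ⊥ᶠ      = refl
ren-as-sub ρ (A ∧ B) = cong₂ _∧_ (ren-as-sub ρ A) (ren-as-sub ρ B)
ren-as-sub ρ (A ∨ B) = cong₂ _∨_ (ren-as-sub ρ A) (ren-as-sub ρ B)
ren-as-sub ρ (A ⊓ B) = cong₂ _⊓_ (ren-as-sub ρ A) (ren-as-sub ρ B)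
ren-as-sub ρ (A ⊔ B) = cong₂ _⊔_ (ren-as-sub ρ A) (ren-as-sub ρ B)
ren-as-sub ρ (Πᶠ A)  = cong Πᶠ (trans (ren-as-sub (extR ρ) A) (sub-cong (extR-as-extS ρ) A))
ren-as-sub ρ (Σᶠ A)  = cong Σᶠ (trans (ren-as-sub (extR ρ) A) (sub-cong (extR-as-extS ρ) A))
ren-as-sub ρ (⊓ᶠ A)  = cong ⊓ᶠ (trans (ren-as-sub (extR ρ) A) (sub-cong (extR-as-extS ρ) A))
ren-as-sub ρ (⊔ᶠ A)  = cong ⊔ᶠ (trans (ren-as-sub (extR ρ) A) (sub-cong (extR-as-extS ρ) A))

subT-renT : ∀ {k m n} (σ : Fin m → Term n) (ρ : Fin k → Fin m) t →
            subT σ (renT ρ t) ≡ subT (σ ∘ ρ) t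
subT-renT σ ρ (var i) = refl
subT-renT σ ρ `0      = refl
subT-renT σ ρ (S t)   = cong S (subT-renT σ ρ t)
subT-renT σ ρ (t ⊕ u) = cong₂ _⊕_ (subT-renT σ ρ t) (subT-renT σ ρ u)
subT-renT σ ρ (t ⊗ u) = cong₂ _⊗_ (subT-renT σ ρ t) (subT-renT σ ρ u)

renT-subT : ∀ {k m n} (ρ : Fin m → Fin n) (σ : Fin k → Term m) t →
            renT ρ (subT σ t) ≡ subT (renT ρ ∘ σ) t
renT-subT ρ σ (var i) = refl
renT-subT ρ σ `0      = refl
renT-subT ρ σ (S t)   = cong S (renT-subT ρ σ t)
renT-subT ρ σ (t ⊕ u) = cong₂ _⊕_ (renT-subT ρ σ t) (renT-subT ρ σ u)
renT-subT ρ σ (t ⊗ u) = cong₂ _⊗_ (renT-subT ρ σ t) (renT-subT ρ σ u)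

subT-subT : ∀ {k m n} (σ : Fin m → Term n) (τ : Fin k → Term m) t →
            subT σ (subT τ t) ≡ subT (subT σ ∘ τ) t
subT-subT σ τ (var i) = refl
subT-subT σ τ `0      = refl
subT-subT σ τ (S t)   = cong S (subT-subT σ τ t)
subT-subT σ τ (t ⊕ u) = cong₂ _⊕_ (subT-subT σ τ t) (subT-subT σ τ u)
subT-subT σ τ (t ⊗ u) = cong₂ _⊗_ (subT-subT σ τ t) (subT-subT σ τ u)

extS-∘ : ∀ {k m n} (σ : Fin m → Term n) (τ : Fin k → Term m) →
         subT (extS σ) ∘ extS τ ≗ extS (subT σ ∘ τ)
extS-∘ σ τ zero    = refl
extS-∘ σ τ (suc i) = trans (subT-renT (extS σ) suc (τ i)) (sym (renT-subT suc σ (τ i)))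

sub-sub : ∀ {k m n} (σ : Fin m → Term n) (τ : Fin k → Term m) A →
          sub σ (sub τ A) ≡ sub (subT σ ∘ τ) A
sub-sub σ τ (t ≐ u) = cong₂ _≐_ (subT-subT σ τ t) (subT-subT σ τ u)
sub-sub σ τ (t ≠ u) = cong₂ _≠_ (subT-subT σ τ t) (subT-subT σ τ u)
sub-sub σ τ ⊤ᶠ      = refl
sub-sub σ τ ⊥ᶠ      = refl
sub-sub σ τ (A ∧ B) = cong₂ _∧_ (sub-sub σ τ A) (sub-sub σ τ B)
sub-sub σ τ (A ∨ B) = cong₂ _∨_ (sub-sub σ τ A) (sub-sub σ τ B)
sub-sub σ τ (A ⊓ B) = cong₂ _⊓_ (sub-sub σ τ A) (sub-sub σ τ B)
sub-sub σ τ (A ⊔ B) = cong₂ _⊔_ (sub-sub σ τ A) (sub-sub σ τ B)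
sub-sub σ τ (Πᶠ A)  = cong Πᶠ (trans (sub-sub (extS σ) (extS τ) A) (sub-cong (extS-∘ σ τ) A))
sub-sub σ τ (Σᶠ A)  = cong Σᶠ (trans (sub-sub (extS σ) (extS τ) A) (sub-cong (extS-∘ σ τ) A))
sub-sub σ τ (⊓ᶠ A)  = cong ⊓ᶠ (trans (sub-sub (extS σ) (extS τ) A) (sub-cong (extS-∘ σ τ) A))
sub-sub σ τ (⊔ᶠ A)  = cong ⊔ᶠ (trans (sub-sub (extS σ) (extS τ) A) (sub-cong (extS-∘ σ τ) A))

ren-sub : ∀ {k m n} (ρ : Fin m → Fin n) (τ : Fin k → Term m) A →
          ren ρ (sub τ A) ≡ sub (renT ρ ∘ τ) A
ren-sub ρ τ A = trans (ren-as-sub ρ (sub τ A))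
  (trans (sub-sub (var ∘ ρ) τ A) (sub-cong (λ i → sym (renT-as-subT ρ (τ i))) A))

sub-ren : ∀ {k m n} (σ : Fin m → Term n) (ρ : Fin k → Fin m) A →
          sub σ (ren ρ A) ≡ sub (σ ∘ ρ) A
sub-ren σ ρ A = trans (cong (sub σ) (ren-as-sub ρ A)) (sub-sub σ (var ∘ ρ) A)

ren-ren : ∀ {k m n} (ρ : Fin m → Fin n) (ρ' : Fin k → Fin m) A → ren ρ (ren ρ' A) ≡ ren (ρ ∘ ρ') A
ren-ren ρ ρ' A = trans (ren-as-sub ρ (ren ρ' A)) (trans (sub-ren _ ρ' A) (sym (ren-as-sub (ρ ∘ ρ') A)))

subT-id : ∀ {n} {σ : Fin n → Term n} → σ ≗ var → ∀ t → subT σ t ≡ t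
subT-id e (var i) = e i
subT-id e `0      = refl
subT-id e (S t)   = cong S (subT-id e t)
subT-id e (t ⊕ u) = cong₂ _⊕_ (subT-id e t) (subT-id e u)
subT-id e (t ⊗ u) = cong₂ _⊗_ (subT-id e t) (subT-id e u)

extS-id : ∀ {n} {σ : Fin n → Term n} → σ ≗ var → extS σ ≗ var
extS-id e zero    = refl
extS-id e (suc i) = cong (renT suc) (e i)

sub-id : ∀ {n} {σ : Fin n → Term n} → σ ≗ var → ∀ A → sub σ A ≡ A
sub-id e (t ≐ u) = cong₂ _≐_ (subT-id e t) (subT-id e u)
sub-id e (t ≠ u) = cong₂ _≠_ (subT-id e t) (subT-id e u)
sub-id e ⊤ᶠ      = refl
sub-id e ⊥ᶠ      = refl
sub-id e (A ∧ B) = cong₂ _∧_ (sub-id e A) (sub-id e B)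
sub-id e (A ∨ B) = cong₂ _∨_ (sub-id e A) (sub-id e B)
sub-id e (A ⊓ B) = cong₂ _⊓_ (sub-id e A) (sub-id e B)
sub-id e (A ⊔ B) = cong₂ _⊔_ (sub-id e A) (sub-id e B)
sub-id e (Πᶠ A)  = cong Πᶠ (sub-id (extS-id e) A)
sub-id e (Σᶠ A)  = cong Σᶠ (sub-id (extS-id e) A)
sub-id e (⊓ᶠ A)  = cong ⊓ᶠ (sub-id (extS-id e) A)
sub-id e (⊔ᶠ A)  = cong ⊔ᶠ (sub-id (extS-id e) A)

sub-neg : ∀ {m n} (σ : Fin m → Term n) A → sub σ (neg A) ≡ neg (sub σ A)
sub-neg σ (t ≐ u) = refl
sub-neg σ (t ≠ u) = refl
sub-neg σ ⊤ᶠ      = refl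
sub-neg σ ⊥ᶠ      = refl
sub-neg σ (A ∧ B) = cong₂ _∨_ (sub-neg σ A) (sub-neg σ B)
sub-neg σ (A ∨ B) = cong₂ _∧_ (sub-neg σ A) (sub-neg σ B)
sub-neg σ (A ⊓ B) = cong₂ _⊔_ (sub-neg σ A) (sub-neg σ B)
sub-neg σ (A ⊔ B) = cong₂ _⊓_ (sub-neg σ A) (sub-neg σ B)
sub-neg σ (Πᶠ A)  = cong Σᶠ (sub-neg (extS σ) A)
sub-neg σ (Σᶠ A)  = cong Πᶠ (sub-neg (extS σ) A)
sub-neg σ (⊓ᶠ A)  = cong ⊔ᶠ (sub-neg (extS σ) A)
sub-neg σ (⊔ᶠ A)  = cong ⊓ᶠ (sub-neg (extS σ) A)

ren-neg : ∀ {m n} (ρ : Fin m → Fin n) A → ren ρ (neg A) ≡ neg (ren ρ A)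
ren-neg ρ A = trans (ren-as-sub ρ (neg A))
  (trans (sub-neg (var ∘ ρ) A) (cong neg (sym (ren-as-sub ρ A))))

neg-involutive : ∀ {n} (A : Formula n) → neg (neg A) ≡ A
neg-involutive (t ≐ u) = refl
neg-involutive (t ≠ u) = refl
neg-involutive ⊤ᶠ      = refl
neg-involutive ⊥ᶠ      = refl
neg-involutive (A ∧ B) = cong₂ _∧_ (neg-involutive A) (neg-involutive B)
neg-involutive (A ∨ B) = cong₂ _∨_ (neg-involutive A) (neg-involutive B)
neg-involutive (A ⊓ B) = cong₂ _⊓_ (neg-involutive A) (neg-involutive B)
neg-involutive (A ⊔ B) = cong₂ _⊔_ (neg-involutive A) (neg-involutive B)
neg-involutive (Πᶠ A)  = cong Πᶠ (neg-involutive A)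
neg-involutive (Σᶠ A)  = cong Σᶠ (neg-involutive A)
neg-involutive (⊓ᶠ A)  = cong ⊓ᶠ (neg-involutive A)
neg-involutive (⊔ᶠ A)  = cong ⊔ᶠ (neg-involutive A)

sub-⇒ : ∀ {m n} (σ : Fin m → Term n) A B → sub σ (A ⇒ B) ≡ (sub σ A ⇒ sub σ B)
sub-⇒ σ A B = cong (_∨ sub σ B) (sub-neg σ A)

sub-⇔ : ∀ {m n} (σ : Fin m → Term n) A B → sub σ (A ⇔ B) ≡ (sub σ A ⇔ sub σ B)
sub-⇔ σ A B = cong₂ _∧_ (sub-⇒ σ A B) (sub-⇒ σ B A)

sub-conj : ∀ {m n} (σ : Fin m → Term n) (As : List (Formula m)) →
           sub σ (conj As) ≡ conj (map (sub σ) As)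
sub-conj σ []       = refl
sub-conj σ (A ∷ As) = cong (sub σ A ∧_) (sub-conj σ As)

ren-extR-suc-[var0] : ∀ {n} (B : Formula (suc n)) → ren (extR suc) B [ var zero ]₀ ≡ B
ren-extR-suc-[var0] B =
  trans (sub-ren _ (extR suc) B) (sub-id (λ { zero → refl ; (suc i) → refl }) B)

extS-[]₀ : ∀ {m n} (σ : Fin m → Term n) t (A : Formula (suc m)) →
           sub (extS σ) A [ t ]₀ ≡ sub (t ∷ᵛ σ) A
extS-[]₀ σ t A = trans (sub-sub _ (extS σ) A) (sub-cong pointwise A)
  where
    pointwise : subT _ ∘ extS σ ≗ t ∷ᵛ σ
    pointwise zero    = refl
    pointwise (suc i) = trans (subT-renT _ suc (σ i)) (subT-id (λ _ → refl) (σ i))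

app-as-sub : ∀ {a n} (φ : Rep a) (X : Fin a → Term n) z → app φ X z ≡ sub (z ∷ᵛ X) φ
app-as-sub φ X z = sub-cong (λ { zero → refl ; (suc i) → refl }) φ

sub-app : ∀ {a m n} (σ : Fin m → Term n) (φ : Rep a) (X : Fin a → Term m) z →
          sub σ (app φ X z) ≡ sub (subT σ z ∷ᵛ (subT σ ∘ X)) φ
sub-app σ φ X z = trans (cong (sub σ) (app-as-sub φ X z))
  (trans (sub-sub σ (z ∷ᵛ X) φ) (sub-cong (λ { zero → refl ; (suc i) → refl }) φ))

ren-app : ∀ {a k} (φ : Rep a) (ρ : Fin a → Fin k) v →
          wk (app φ (var ∘ ρ) (var v)) ≡ app φ (var ∘ suc ∘ ρ) (var (suc v))
ren-app φ ρ v = trans (ren-sub suc _ φ) (sub-cong (λ { zero → refl ; (suc i) → refl }) φ)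

wkN : ∀ k → Formula 0 → Formula k
wkN zero    A = A
wkN (suc k) A = wk (wkN k A)

wkN-as-sub : ∀ k (A : Formula 0) → wkN k A ≡ sub (λ ()) A
wkN-as-sub zero    A = sym (sub-id (λ ()) A)
wkN-as-sub (suc k) A =
  trans (cong wk (wkN-as-sub k A)) (trans (ren-sub suc _ A) (sub-cong (λ ()) A))

closedTo-neg : ∀ k (A : Formula 0) → closedTo (neg A) ≡ neg (wkN k A)
closedTo-neg k A = trans (ren-neg _ A)
  (cong neg (trans (ren-as-sub _ A) (trans (sub-cong (λ ()) A) (sym (wkN-as-sub k A)))))

elem-sub : ∀ {m n} (σ : Fin m → Term n) {A} → Elem A → Elem (sub σ A)
elem-sub σ eq        = eq
elem-sub σ neq       = neq
elem-sub σ top       = top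
elem-sub σ bot       = bot
elem-sub σ (and a b) = and (elem-sub σ a) (elem-sub σ b)
elem-sub σ (or a b)  = or (elem-sub σ a) (elem-sub σ b)
elem-sub σ (all a)   = all (elem-sub (extS σ) a)
elem-sub σ (ex a)    = ex (elem-sub (extS σ) a)

elem-ren : ∀ {m n} (ρ : Fin m → Fin n) {A} → Elem A → Elem (ren ρ A)
elem-ren ρ eq        = eq
elem-ren ρ neq       = neq
elem-ren ρ top       = top
elem-ren ρ bot       = bot
elem-ren ρ (and a b) = and (elem-ren ρ a) (elem-ren ρ b)
elem-ren ρ (or a b)  = or (elem-ren ρ a) (elem-ren ρ b)
elem-ren ρ (all a)   = all (elem-ren (extR ρ) a)
elem-ren ρ (ex a)    = ex (elem-ren (extR ρ) a)

elem-wkN : ∀ k {A : Formula 0} → Elem A → Elem (wkN k A)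
elem-wkN zero    a = a
elem-wkN (suc k) a = elem-ren suc (elem-wkN k a)

elem-neg : ∀ {n} {A : Formula n} → Elem A → Elem (neg A)
elem-neg eq        = neq
elem-neg neq       = eq
elem-neg top       = bot
elem-neg bot       = top
elem-neg (and a b) = or (elem-neg a) (elem-neg b)
elem-neg (or a b)  = and (elem-neg a) (elem-neg b)
elem-neg (all a)   = ex (elem-neg a)
elem-neg (ex a)    = all (elem-neg a)

elem-⇒ : ∀ {n} {A B : Formula n} → Elem A → Elem B → Elem (A ⇒ B)
elem-⇒ a b = or (elem-neg a) b

elem-⇔ : ∀ {n} {A B : Formula n} → Elem A → Elem B → Elem (A ⇔ B)
elem-⇔ a b = and (elem-⇒ a b) (elem-⇒ b a)

elem-∀cl : ∀ {n} {A : Formula n} → Elem A → Elem (∀cl A)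
elem-∀cl {zero}  a = a
elem-∀cl {suc n} a = elem-∀cl (all a)

elem-conj : ∀ {n} {As : List (Formula n)} → All Elem As → Elem (conj As)
elem-conj []       = top
elem-conj (a ∷ as) = and a (elem-conj as)

elem-‖‖ : ∀ {n} {A : Formula n} → Elem A → ‖ A ‖ ≡ A
elem-‖‖ eq        = refl
elem-‖‖ neq       = refl
elem-‖‖ top       = refl
elem-‖‖ bot       = refl
elem-‖‖ (and a b) = cong₂ _∧_ (elem-‖‖ a) (elem-‖‖ b)
elem-‖‖ (or a b)  = cong₂ _∨_ (elem-‖‖ a) (elem-‖‖ b)
elem-‖‖ (all a)   = cong Πᶠ (elem-‖‖ a)
elem-‖‖ (ex a)    = cong Σᶠ (elem-‖‖ a)

elem-PAAx : ∀ {A} → PAAx A → Elem A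
elem-PAAx pa1         = all neq
elem-PAAx pa2         = all (all (elem-⇒ eq eq))
elem-PAAx pa3         = all eq
elem-PAAx pa4         = all (all eq)
elem-PAAx pa5         = all eq
elem-PAAx pa6         = all (all eq)
elem-PAAx (pa7 F e)   =
  elem-∀cl (elem-⇒ (and (elem-sub _ e) (all (elem-⇒ e (elem-sub _ e)))) (all e))

-- A sequent Y ◦– F in which no resource has a surface ⊔ and F has no surface ⊓
-- leaves the environment no move.
data NoSurface (k : Kind) {n : ℕ} : Formula n → Set where
  ≐ₙ   : ∀ {t u} → NoSurface k (t ≐ u)
  ≠ₙ   : ∀ {t u} → NoSurface k (t ≠ u)
  ⊤ₙ   : NoSurface k ⊤ᶠ
  ⊥ₙ   : NoSurface k ⊥ᶠ
  ∧ₙ   : ∀ {A B} → NoSurface k A → NoSurface k B → NoSurface k (A ∧ B)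
  ∨ₙ   : ∀ {A B} → NoSurface k A → NoSurface k B → NoSurface k (A ∨ B)
  Πₙ   : ∀ {A} → NoSurface k A → NoSurface k (Πᶠ A)
  Σₙ   : ∀ {A} → NoSurface k A → NoSurface k (Σᶠ A)
  ⊓ₙ   : ∀ {A B} → k ≡ sqcup → NoSurface k (A ⊓ B)
  ⊔ₙ   : ∀ {A B} → k ≡ sqcap → NoSurface k (A ⊔ B)
  ⊓ᶠₙ  : ∀ {A} → k ≡ sqcup → NoSurface k (⊓ᶠ A)
  ⊔ᶠₙ  : ∀ {A} → k ≡ sqcap → NoSurface k (⊔ᶠ A)

elem⇒noSurface : ∀ {k n} {A : Formula n} → Elem A → NoSurface k A
elem⇒noSurface eq        = ≐ₙ
elem⇒noSurface neq       = ≠ₙ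
elem⇒noSurface top       = ⊤ₙ
elem⇒noSurface bot       = ⊥ₙ
elem⇒noSurface (and a b) = ∧ₙ (elem⇒noSurface a) (elem⇒noSurface b)
elem⇒noSurface (or a b)  = ∨ₙ (elem⇒noSurface a) (elem⇒noSurface b)
elem⇒noSurface (all a)   = Πₙ (elem⇒noSurface a)
elem⇒noSurface (ex a)    = Σₙ (elem⇒noSurface a)

noSurface-ren : ∀ {k m n} (ρ : Fin m → Fin n) {A} → NoSurface k A → NoSurface k (ren ρ A)
noSurface-ren ρ ≐ₙ        = ≐ₙ
noSurface-ren ρ ≠ₙ        = ≠ₙ
noSurface-ren ρ ⊤ₙ        = ⊤ₙ
noSurface-ren ρ ⊥ₙ        = ⊥ₙ
noSurface-ren ρ (∧ₙ a b)  = ∧ₙ (noSurface-ren ρ a) (noSurface-ren ρ b)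
noSurface-ren ρ (∨ₙ a b)  = ∨ₙ (noSurface-ren ρ a) (noSurface-ren ρ b)
noSurface-ren ρ (Πₙ a)    = Πₙ (noSurface-ren (extR ρ) a)
noSurface-ren ρ (Σₙ a)    = Σₙ (noSurface-ren (extR ρ) a)
noSurface-ren ρ (⊓ₙ e)    = ⊓ₙ e
noSurface-ren ρ (⊔ₙ e)    = ⊔ₙ e
noSurface-ren ρ (⊓ᶠₙ e)   = ⊓ᶠₙ e
noSurface-ren ρ (⊔ᶠₙ e)   = ⊔ᶠₙ e

noSurface-wkN : ∀ {k} r {A : Formula 0} → NoSurface k A → NoSurface k (wkN r A)
noSurface-wkN zero    a = a
noSurface-wkN (suc r) a = noSurface-ren suc (noSurface-wkN r a)

noSurface-⊓cl : ∀ r {B : Formula r} → NoSurface sqcup B → NoSurface sqcup (⊓cl B)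
noSurface-⊓cl zero    b = b
noSurface-⊓cl (suc r) b = noSurface-⊓cl r (⊓ᶠₙ refl)

noSurface-¬bin : ∀ {k n} {A B : Formula n} → NoSurface k (bin k A B) → ⊥
noSurface-¬bin {sqcap} (⊓ₙ ())
noSurface-¬bin {sqcup} (⊔ₙ ())

noSurface-¬qch : ∀ {k n} {A : Formula (suc n)} → NoSurface k (qch k A) → ⊥
noSurface-¬qch {sqcap} (⊓ᶠₙ ())
noSurface-¬qch {sqcup} (⊔ᶠₙ ())

noSurface-¬Bin : ∀ {k n} {A A' : Formula n} → NoSurface k A → Bin k A A' → ⊥
noSurface-¬Bin a        pick₀  = noSurface-¬bin a
noSurface-¬Bin a        pick₁  = noSurface-¬bin a
noSurface-¬Bin (∧ₙ a b) (∧ˡ x) = noSurface-¬Bin a x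
noSurface-¬Bin (∧ₙ a b) (∧ʳ x) = noSurface-¬Bin b x
noSurface-¬Bin (∨ₙ a b) (∨ˡ x) = noSurface-¬Bin a x
noSurface-¬Bin (∨ₙ a b) (∨ʳ x) = noSurface-¬Bin b x
noSurface-¬Bin (Πₙ a)   (Πc x) = noSurface-¬Bin a x
noSurface-¬Bin (Σₙ a)   (Σc x) = noSurface-¬Bin a x

noSurface-¬Fresh : ∀ {k n} {A : Formula n} {A'} → NoSurface k A → Fresh k A A' → ⊥
noSurface-¬Fresh a        base   = noSurface-¬qch a
noSurface-¬Fresh (∧ₙ a b) (∧ˡ x) = noSurface-¬Fresh a x
noSurface-¬Fresh (∧ₙ a b) (∧ʳ x) = noSurface-¬Fresh b x
noSurface-¬Fresh (∨ₙ a b) (∨ˡ x) = noSurface-¬Fresh a x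
noSurface-¬Fresh (∨ₙ a b) (∨ʳ x) = noSurface-¬Fresh b x
noSurface-¬Fresh (Πₙ a)   (Πc x) = noSurface-¬Fresh a x
noSurface-¬Fresh (Σₙ a)   (Σc x) = noSurface-¬Fresh a x

noSurface-¬OneL : ∀ {k n} {Y Y' : List (Formula n)} →
                  All (NoSurface k) Y → OneL (Bin k) Y Y' → ⊥
noSurface-¬OneL (a ∷ as) (here b)  = noSurface-¬Bin a b
noSurface-¬OneL (a ∷ as) (there o) = noSurface-¬OneL as o

noSurface-¬OneFresh : ∀ {k n} {Y : List (Formula n)} {Y'} →
                      All (NoSurface k) Y → OneFresh k Y Y' → ⊥
noSurface-¬OneFresh (a ∷ as) (here f)  = noSurface-¬Fresh a f
noSurface-¬OneFresh (a ∷ as) (there o) = noSurface-¬OneFresh as o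

⊢T-mono : ∀ {n} {Γ Δ : List (Formula n)} → Γ ⊆ Δ → ⊢T Γ → ⊢T Δ
⊢T-mono s (ax p q)   = ax (s p) (s q)
⊢T-mono s (top p)    = top (s p)
⊢T-mono s (and p d e) = and (s p) (⊢T-mono (∷⁺ʳ _ s) d) (⊢T-mono (∷⁺ʳ _ s) e)
⊢T-mono s (or p d)   = or (s p) (⊢T-mono (∷⁺ʳ _ (∷⁺ʳ _ s)) d)
⊢T-mono s (all p d)  = all (s p) (⊢T-mono (∷⁺ʳ _ (map-⊆ wk s)) d)
⊢T-mono s (ex p t d) = ex (s p) t (⊢T-mono (∷⁺ʳ _ s) d)

⊢T-id : ∀ {n} {Γ : List (Formula n)} {A} → Elem A → A ∈ Γ → neg A ∈ Γ → ⊢T Γ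
⊢T-id eq  p q = ax p q
⊢T-id neq p q = ax q p
⊢T-id top p q = top p
⊢T-id bot p q = top q
⊢T-id (and a b) p q =
  and p (or (there q) (⊢T-id a (there (there (here refl))) (here refl)))
        (or (there q) (⊢T-id b (there (there (here refl))) (there (here refl))))
⊢T-id (or a b) p q =
  and q (or (there p) (⊢T-id a (here refl) (there (there (here refl)))))
        (or (there p) (⊢T-id b (there (here refl)) (there (there (here refl)))))
⊢T-id {Γ = Γ} (all {A} a) p q =
  all p (ex (there (∈-map⁺ wk q)) (var zero)
    (subst (λ X → ⊢T (X ∷ A ∷ map wk Γ)) (sym (ren-extR-suc-[var0] (neg A)))
      (⊢T-id a (there (here refl)) (here refl))))
⊢T-id {Γ = Γ} (ex {A} a) p q =
  all q (ex (there (∈-map⁺ wk p)) (var zero)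
    (subst (λ X → ⊢T (X ∷ neg A ∷ map wk Γ)) (sym (ren-extR-suc-[var0] A))
      (⊢T-id a (here refl) (there (here refl)))))

⊢T-⇒ : ∀ {n} {Γ : List (Formula n)} {A B} → neg (A ⇒ B) ∈ Γ →
       (∀ {Δ} → Γ ⊆ Δ → A ∈ Δ → ⊢T Δ) → (∀ {Δ} → Γ ⊆ Δ → neg B ∈ Δ → ⊢T Δ) → ⊢T Γ
⊢T-⇒ {A = A} m kA kB =
  and m (kA there (here (sym (neg-involutive A)))) (kB there (here refl))

⊢T-⇔ : ∀ {n} {Γ : List (Formula n)} {A B} → Elem A → neg (A ⇔ B) ∈ Γ → A ∈ Γ →
       (∀ {Δ} → Γ ⊆ Δ → B ∈ Δ → ⊢T Δ) → ⊢T Γ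
⊢T-⇔ {B = B} a m p kB =
  or m (and (there (here refl))
            (kB (λ q → there (there (there q))) (here (sym (neg-involutive B))))
            (⊢T-id a (there (there (there p))) (here refl)))

⊢T-conj : ∀ {n} {Γ : List (Formula n)} {As} → All Elem As →
          conj As ∈ Γ → (∀ {A} → A ∈ As → neg A ∈ Γ) → ⊢T Γ
⊢T-conj []       p negs = top p
⊢T-conj (a ∷ as) p negs =
  and p (⊢T-id a (here refl) (there (negs (here refl))))
        (⊢T-conj as (here refl) (λ q → there (negs (there q))))

⊢T-∀cl-inst : ∀ {k n} {Γ : List (Formula n)} (A : Formula k) → closedTo (neg (∀cl A)) ∈ Γ →
              (σ : Fin k → Term n) → ⊢T (sub σ (neg A) ∷ Γ) → ⊢T Γ
⊢T-∀cl-inst {zero} {Γ = Γ} A p σ d =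
  ⊢T-mono (λ { (here refl) → subst (_∈ Γ) closed p ; (there q) → q }) d
  where
    closed : closedTo (neg A) ≡ sub σ (neg A)
    closed = trans (ren-as-sub _ (neg A)) (sub-cong (λ ()) (neg A))
⊢T-∀cl-inst {suc k} {Γ = Γ} A p σ d =
  ⊢T-∀cl-inst (Πᶠ A) p (σ ∘ suc)
    (ex (here refl) (σ zero)
      (subst (λ X → ⊢T (X ∷ Σᶠ (sub (extS (σ ∘ suc)) (neg A)) ∷ Γ)) (sym instance-σ)
        (⊢T-mono (∷⁺ʳ _ there) d)))
  where
    instance-σ : sub (extS (σ ∘ suc)) (neg A) [ σ zero ]₀ ≡ sub σ (neg A)
    instance-σ = trans (extS-[]₀ (σ ∘ suc) (σ zero) (neg A))
                       (sub-cong (λ { zero → refl ; (suc i) → refl }) (neg A))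

⊢T-use : ∀ {k n} {Γ : List (Formula n)} (A : Formula k) → neg (wkN n (∀cl A)) ∈ Γ →
         (σ : Fin k → Term n) → ∀ {A'} → sub σ A ≡ A' → ⊢T (neg A' ∷ Γ) → ⊢T Γ
⊢T-use {n = n} {Γ} A m σ refl d =
  ⊢T-∀cl-inst A (subst (_∈ Γ) (sym (closedTo-neg n (∀cl A))) m) σ
    (subst (λ X → ⊢T (X ∷ Γ)) (sym (sub-neg σ A)) d)

negEqAxioms : ∀ {n} → List (Formula n)
negEqAxioms = map (λ A → neg (closedTo A)) EqAxioms

⊢T-refl : ∀ {n} {Γ : List (Formula n)} {t} →
          (t ≐ t) ∈ Γ → Σᶠ (var zero ≠ var zero) ∈ Γ → ⊢T Γ
⊢T-refl {t = t} p r = ex r t (ax (there p) (here refl))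

refl-axiom∈ : ∀ {n} (Γ : List (Formula n)) → Σᶠ (var zero ≠ var zero) ∈ (Γ ++ negEqAxioms)
refl-axiom∈ Γ = ∈-++⁺ʳ Γ (here refl)

-- Strategies in CL12

wait-⊓ᶠ : ∀ {n} {Y : List (Formula n)} {B} → All (NoSurface sqcup) Y →
          map wk Y ◦– B → Y ◦– ⊓ᶠ B
wait-⊓ᶠ quiet d = wait (top (here refl))
  (λ { (right ()) ; (left o) → ⊥-elim (noSurface-¬OneL quiet o) })
  (λ { (right base) → d ; (left o) → ⊥-elim (noSurface-¬OneFresh quiet o) })

wait-⊓cl : ∀ r (B : Formula r) (Y : List (Formula 0)) → All (NoSurface sqcup) Y →
           map (wkN r) Y ◦– B → Y ◦– ⊓cl B
wait-⊓cl zero    B Y quiet d = subst (_◦– B) (map-id Y) d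
wait-⊓cl (suc r) B Y quiet d =
  wait-⊓cl r (⊓ᶠ B) Y quiet
    (wait-⊓ᶠ (map⁺ (All.map (noSurface-wkN r) quiet)) (subst (_◦– B) (map-∘ Y) d))

noSurface-¬OneL-⊔ᶠ : ∀ {n} (P : List (Formula n)) {Q B Y'} →
                     All (NoSurface sqcup) P → All (NoSurface sqcup) Q →
                     OneL (Bin sqcup) (P ++ ⊔ᶠ B ∷ Q) Y' → ⊥
noSurface-¬OneL-⊔ᶠ []      qP       qQ (here ())
noSurface-¬OneL-⊔ᶠ []      qP       qQ (there o) = noSurface-¬OneL qQ o
noSurface-¬OneL-⊔ᶠ (_ ∷ P) (q ∷ qP) qQ (here b)  = noSurface-¬Bin q b
noSurface-¬OneL-⊔ᶠ (_ ∷ P) (q ∷ qP) qQ (there o) = noSurface-¬OneL-⊔ᶠ P qP qQ o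

OneFresh-⊔ᶠ : ∀ {n} (P : List (Formula n)) {Q B Y'} →
              All (NoSurface sqcup) P → All (NoSurface sqcup) Q →
              OneFresh sqcup (P ++ ⊔ᶠ B ∷ Q) Y' → Y' ≡ map wk P ++ B ∷ map wk Q
OneFresh-⊔ᶠ []      qP       qQ (here base) = refl
OneFresh-⊔ᶠ []      qP       qQ (there o)   = ⊥-elim (noSurface-¬OneFresh qQ o)
OneFresh-⊔ᶠ (_ ∷ P) (q ∷ qP) qQ (here f)    = ⊥-elim (noSurface-¬Fresh q f)
OneFresh-⊔ᶠ (A ∷ P) (q ∷ qP) qQ (there o)   = cong (wk A ∷_) (OneFresh-⊔ᶠ P qP qQ o)

wait-⊔ᶠˡ : ∀ {n} (P Q : List (Formula n)) {B F} →
           All (NoSurface sqcup) P → All (NoSurface sqcup) Q → NoSurface sqcap F →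
           (map wk P ++ B ∷ map wk Q) ◦– wk F → (P ++ ⊔ᶠ B ∷ Q) ◦– F
wait-⊔ᶠˡ P Q {B} {F} qP qQ qF d =
  wait (top (there (∈-++⁺ˡ (∈-map⁺ (λ E → neg ‖ E ‖) (∈-++⁺ʳ P (here refl))))))
    (λ { (right b) → ⊥-elim (noSurface-¬Bin qF b)
       ; (left o)  → ⊥-elim (noSurface-¬OneL-⊔ᶠ P qP qQ o) })
    (λ { (right f) → ⊥-elim (noSurface-¬Fresh qF f)
       ; (left o)  → subst (_◦– wk F) (sym (OneFresh-⊔ᶠ P qP qQ o)) d })

elementary-◦– : ∀ {n} {Y : List (Formula n)} {F} → All Elem Y → Elem F →
                ⊢T ((F ∷ map neg Y) ++ negEqAxioms) → Y ◦– F
elementary-◦– {Y = Y} eY eF d =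
  wait (subst (λ X → ⊢T (X ++ negEqAxioms)) (sym (cong₂ _∷_ (elem-‖‖ eF) (‖‖-neg eY))) d)
    (λ { (right b) → ⊥-elim (noSurface-¬Bin (elem⇒noSurface eF) b)
       ; (left o)  → ⊥-elim (noSurface-¬OneL (All.map elem⇒noSurface eY) o) })
    (λ { (right f) → ⊥-elim (noSurface-¬Fresh (elem⇒noSurface eF) f)
       ; (left o)  → ⊥-elim (noSurface-¬OneFresh (All.map elem⇒noSurface eY) o) })
  where
    ‖‖-neg : ∀ {Z : List (Formula _)} → All Elem Z → map (λ E → neg ‖ E ‖) Z ≡ map neg Z
    ‖‖-neg []       = refl
    ‖‖-neg (e ∷ es) = cong₂ _∷_ (cong neg (elem-‖‖ e)) (‖‖-neg es)

OneL-at : ∀ {A : Set} {R : A → A → Set} (P : List A) {x y Q} → R x y →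
          OneL R (P ++ x ∷ Q) (P ++ y ∷ Q)
OneL-at []      r = here r
OneL-at (_ ∷ P) r = there (OneL-at P r)

choose-⊓clˡ : ∀ {n} {F : Formula n} (P Q : List (Formula n)) r (B : Formula r)
              (σ : Fin r → Term n) → (∀ i → Choosable (σ i)) → (τ : Fin 0 → Term n) →
              (P ++ sub σ B ∷ Q) ◦– F → (P ++ sub τ (⊓cl B) ∷ Q) ◦– F
choose-⊓clˡ {F = F} P Q zero B σ choosable τ d =
  subst (λ X → (P ++ X ∷ Q) ◦– F) (sub-cong (λ ()) B) d
choose-⊓clˡ {F = F} P Q (suc r) B σ choosable τ d =
  choose-⊓clˡ P Q r (⊓ᶠ B) (σ ∘ suc) (choosable ∘ suc) τ
    (choose (leftQ (choosable zero) (OneL-at P base))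
      (subst (λ X → (P ++ X ∷ Q) ◦– F) (sym instance-σ) d))
  where
    instance-σ : sub (extS (σ ∘ suc)) B [ σ zero ]₀ ≡ sub σ B
    instance-σ = trans (extS-[]₀ (σ ∘ suc) (σ zero) B)
                       (sub-cong (λ { zero → refl ; (suc i) → refl }) B)

-- The extra innermost argument is vacuous: its ⊓ keeps the resource free of
-- surface ⊔, hence inert until queried, also for 0-ary functions.
Resource : ∀ a → Rep a → Formula 0
Resource a φ = ⊓cl {suc a} (⊔ᶠ (ren (extR suc) φ))

noSurface-Resource : ∀ a (φ : Rep a) → NoSurface sqcup (Resource a φ)
noSurface-Resource a φ = noSurface-⊓cl a (⊓ᶠₙ refl)

query : ∀ {n} {F : Formula n} (P Q : List (Formula n)) a (φ : Rep a) (ρ : Fin a → Fin n) →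
        All (NoSurface sqcup) P → All (NoSurface sqcup) Q → NoSurface sqcap F →
        (map wk P ++ app φ (var ∘ suc ∘ ρ) (var zero) ∷ map wk Q) ◦– wk F →
        (P ++ wkN n (Resource a φ) ∷ Q) ◦– F
query {n} {F} P Q a φ ρ qP qQ qF d =
  subst (λ X → (P ++ X ∷ Q) ◦– F) (sym (wkN-as-sub n (Resource a φ)))
    (choose-⊓clˡ P Q (suc a) (⊔ᶠ (ren (extR suc) φ)) σ choosable (λ ())
      (wait-⊔ᶠˡ P Q qP qQ qF
        (subst (λ X → (map wk P ++ X ∷ map wk Q) ◦– wk F) (sym answer) d)))
  where
    σ : Fin (suc a) → Term n
    σ = `0 ∷ᵛ (var ∘ ρ)
    choosable : ∀ i → Choosable (σ i)
    choosable zero    = isZero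
    choosable (suc i) = isVar (ρ i)
    answer : sub (extS σ) (ren (extR suc) φ) ≡ app φ (var ∘ suc ∘ ρ) (var zero)
    answer = trans (sub-ren (extS σ) (extR suc) φ) (sub-cong (λ { zero → refl ; (suc i) → refl }) φ)

pa⇒cla7 : ∀ {A} → Elem A → PA⊢ A → CLA7⊢ A
pa⇒cla7 {A} eA (As , axioms , valid) =
  LC As A (λ p → peano (All.lookup axioms p))
    (elementary-◦– (All.map elem-PAAx axioms) eA valid)

pa⇒cla7-All : ∀ {As} → All Elem As → All PA⊢_ As → All CLA7⊢ As
pa⇒cla7-All []       []       = []
pa⇒cla7-All (e ∷ es) (p ∷ ps) = pa⇒cla7 e p ∷ pa⇒cla7-All es ps

copycat : ∀ r (B : Formula (suc r)) → Elem B → CLA7⊢ (⊓cl (⊓ᶠ (neg B) ∨ ⊔ᶠ B))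
copycat r B eB = LC [] (⊓cl (⊓ᶠ (neg B) ∨ ⊔ᶠ B)) (λ ()) (wait-⊓cl r _ [] [] copy)
  where
    answer : [] ◦– (neg B ∨ ren (extR suc) B [ var zero ]₀)
    answer = subst (λ X → [] ◦– (neg B ∨ X)) (sym (ren-extR-suc-[var0] B))
      (elementary-◦– [] (elem-⇒ eB eB)
        (or (here refl) (⊢T-id eB (there (here refl)) (here refl))))
    copy : [] ◦– (⊓ᶠ (neg B) ∨ ⊔ᶠ B)
    copy = wait (or (here refl) (top (here refl)))
      (λ { (right (∨ˡ ())) ; (right (∨ʳ ())) ; (left ()) })
      (λ { (right (∨ˡ base)) → choose (rightQ (isVar zero) (∨ʳ base)) answer
         ; (right (∨ʳ ())) ; (left ()) })

record Computable {a} (φ : Rep a) : Set where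
  field
    elementary : Elem φ
    computed   : CLA7⊢ (⊓cl (⊔ᶠ φ))
open Computable

-- CLA7 induction on the vacuous argument: its step ⊔z φ → ⊔z φ is copycat.
resource : ∀ {a} {φ : Rep a} → Computable φ → CLA7⊢ (Resource a φ)
resource {a} {φ} c =
  ind (⊔ᶠ (ren (extR suc) φ))
    (subst (λ X → CLA7⊢ (⊓cl X)) (sym at0) (computed c))
    (subst (λ X → CLA7⊢ (⊓cl (⊓ᶠ (neg (ren (extR suc) φ)) ∨ X))) (sym atSucc-vacuous)
      (copycat (suc a) (ren (extR suc) φ) (elem-ren _ (elementary c))))
  where
    at0 : ⊔ᶠ (ren (extR suc) φ) [ `0 ]₀ ≡ ⊔ᶠ φ
    at0 = cong ⊔ᶠ (trans (sub-ren _ (extR suc) φ)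
                         (sub-id (λ { zero → refl ; (suc i) → refl }) φ))
    atSucc-vacuous : atSucc (⊔ᶠ (ren (extR suc) φ)) ≡ ⊔ᶠ (ren (extR suc) φ)
    atSucc-vacuous = cong ⊔ᶠ (trans (sub-ren _ (extR suc) φ)
      (trans (sub-cong (λ { zero → refl ; (suc i) → refl }) φ) (sym (ren-as-sub (extR suc) φ))))

-- Initial functions

computable-by-term : ∀ n (φ : Rep n) (t : Term n) → Elem φ → Choosable t →
                     CLA7⊢ (∀cl (app φ (var ∘ suc) (var zero) ⇔ var zero ≐ renT suc t)) →
                     CLA7⊢ (⊓cl (⊔ᶠ φ))
computable-by-term n φ t eφ choosable def =
  LC (D ∷ []) (⊓cl (⊔ᶠ φ)) (λ { (here refl) → def })
    (wait-⊓cl n (⊔ᶠ φ) (D ∷ []) (elem⇒noSurface eD ∷ [])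
      (choose (rightQ choosable base)
        (elementary-◦– (elem-wkN n eD ∷ []) (elem-sub _ eφ) valid)))
  where
    P : Formula (suc n)
    P = app φ (var ∘ suc) (var zero)
    body : Formula (suc n)
    body = P ⇔ var zero ≐ renT suc t
    D : Formula 0
    D = ∀cl body
    eD : Elem D
    eD = elem-∀cl {suc n} (elem-⇔ (elem-sub _ eφ) eq)
    σ : Fin (suc n) → Term n
    σ = t ∷ᵛ var
    instance-σ : sub σ body ≡ (φ [ t ]₀ ⇔ t ≐ t)
    instance-σ = trans (sub-⇔ σ P (var zero ≐ renT suc t)) (cong₂ (λ A u → A ⇔ t ≐ u) P-σ t-σ)
      where
        P-σ : sub σ P ≡ φ [ t ]₀
        P-σ = trans (sub-app σ φ _ _) (sub-cong (λ { zero → refl ; (suc i) → refl }) φ)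
        t-σ : subT σ (renT suc t) ≡ t
        t-σ = trans (subT-renT σ suc t) (subT-id (λ _ → refl) t)
    valid : ⊢T ((φ [ t ]₀ ∷ neg (wkN n D) ∷ []) ++ negEqAxioms)
    valid = ⊢T-use body (there (here refl)) σ instance-σ
      (⊢T-⇔ (elem-sub _ eφ) (here refl) (there (here refl))
        (λ s q → ⊢T-refl q (s (there (refl-axiom∈ (φ [ t ]₀ ∷ neg (wkN n D) ∷ []))))))

computable-succ : (φ : Rep 1) → Elem φ →
                  CLA7⊢ (∀cl {2} (app φ (λ _ → var (suc zero)) (var zero)
                                  ⇔ var zero ≐ S (var (suc zero)))) →
                  CLA7⊢ (⊓cl (⊔ᶠ φ))
computable-succ φ eφ def =
  LC (successorAxiom ∷ D ∷ []) (⊓cl (⊔ᶠ φ)) (λ { (here refl) → succA ; (there (here refl)) → def })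
    (wait-⊓ᶠ (⊓ᶠₙ refl ∷ elem⇒noSurface eD ∷ [])
      (choose (leftQ (isVar zero) (here base))
        (wait-⊔ᶠˡ [] (wk D ∷ []) [] (elem⇒noSurface (elem-ren suc eD) ∷ []) (⊔ᶠₙ refl)
          (choose (rightQ (isVar zero) base)
            (elementary-◦– (eq ∷ elem-ren suc (elem-ren suc eD) ∷ []) (elem-sub _ (elem-ren _ eφ))
              valid)))))
  where
    P : Formula 2
    P = app φ (λ _ → var (suc zero)) (var zero)
    body : Formula 2
    body = P ⇔ var zero ≐ S (var (suc zero))
    D : Formula 0
    D = ∀cl body
    eD : Elem D
    eD = elem-∀cl {2} (elem-⇔ (elem-sub _ eφ) eq)
    P≡answer : P ≡ ren (extR suc) φ [ var zero ]₀
    P≡answer = trans (sub-cong (λ { zero → refl ; (suc zero) → refl }) φ)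
                     (sym (sub-ren _ (extR suc) φ))
    valid : ⊢T ((ren (extR suc) φ [ var zero ]₀ ∷ (var zero ≠ S (var (suc zero))) ∷ neg (wk (wk D)) ∷ [])
                ++ negEqAxioms)
    valid = ⊢T-use body (there (there (here refl))) var (sub-id (λ _ → refl) body)
      (⊢T-⇔ (elem-sub _ eφ) (here refl) (there (here P≡answer))
        (λ s q → ax q (s (there (there (here refl))))))

-- Primitive recursion

computable-by-equivalence : ∀ n a (ψ : Rep n) (χ : Rep a) (ρ : Fin a → Fin n) →
                            Elem ψ → Elem χ → CLA7⊢ (Resource a χ) →
                            CLA7⊢ (∀cl (ψ ⇔ app χ (var ∘ suc ∘ ρ) (var zero))) →
                            CLA7⊢ (⊓cl (⊔ᶠ ψ))
computable-by-equivalence n a ψ χ ρ eψ eχ res def =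
  LC (Resource a χ ∷ D ∷ []) (⊓cl (⊔ᶠ ψ)) (λ { (here refl) → res ; (there (here refl)) → def })
    (wait-⊓cl n (⊔ᶠ ψ) (Resource a χ ∷ D ∷ []) (noSurface-Resource a χ ∷ elem⇒noSurface eD ∷ [])
      (query [] (wkN n D ∷ []) a χ ρ [] (elem⇒noSurface (elem-wkN n eD) ∷ []) (⊔ᶠₙ refl)
        (choose (rightQ (isVar zero) base)
          (elementary-◦– (eQ ∷ elem-wkN (suc n) eD ∷ []) (elem-sub _ (elem-ren _ eψ)) valid))))
  where
    Q : Formula (suc n)
    Q = app χ (var ∘ suc ∘ ρ) (var zero)
    eQ : Elem Q
    eQ = elem-sub _ eχ
    D : Formula 0
    D = ∀cl (ψ ⇔ Q)
    eD : Elem D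
    eD = elem-∀cl (elem-⇔ eψ eQ)
    valid : ⊢T ((ren (extR suc) ψ [ var zero ]₀ ∷ neg Q ∷ neg (wkN (suc n) D) ∷ []) ++ negEqAxioms)
    valid = ⊢T-use (ψ ⇔ Q) (there (there (here refl))) var (sub-id (λ _ → refl) (ψ ⇔ Q))
      (⊢T-⇔ eψ (here refl) (there (here (sym (ren-extR-suc-[var0] ψ))))
        (λ s q → ⊢T-id eQ q (s (there (there (here refl))))))

-- The step equation reads φ(y, x₁, x⃗) → (φS(z, x₁, x⃗) ⇔ χ(z, x₁, y, x⃗)), where
-- φS(z, x₁, x⃗) says z = g(x₁', x⃗).
computable-step : ∀ n (φ φS : Formula (suc (suc n))) (χ : Formula (suc (suc (suc n)))) →
                  Elem φ → Elem φS → Elem χ → CLA7⊢ (Resource (suc (suc n)) χ) →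
                  CLA7⊢ (∀cl (ren suc φ ⇒ (ren (extR suc) φS ⇔ app χ (var ∘ suc ∘ swap01) (var zero)))) →
                  CLA7⊢ (⊓cl (⊓ᶠ (neg φ) ∨ ⊔ᶠ φS))
computable-step n φ φS χ eφ eS eχ res def =
  LC (R ∷ D ∷ []) (⊓cl (⊓ᶠ (neg φ) ∨ ⊔ᶠ φS)) (λ { (here refl) → res ; (there (here refl)) → def })
    (wait-⊓cl (suc n) (⊓ᶠ (neg φ) ∨ ⊔ᶠ φS) (R ∷ D ∷ []) (noSurface-Resource _ χ ∷ elem⇒noSurface eD ∷ [])
      (wait (or (here refl) (top (here refl)))
        (λ { (right (∨ˡ ())) ; (right (∨ʳ ())) ; (left o) → ⊥-elim (noSurface-¬OneL quiet o) })
        (λ { (right (∨ˡ base)) → givenPrevious ; (right (∨ʳ ()))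
           ; (left o) → ⊥-elim (noSurface-¬OneFresh quiet o) })))
  where
    R : Formula 0
    R = Resource (suc (suc n)) χ
    S' : Formula (suc (suc (suc n)))
    S' = ren (extR suc) φS
    eS' : Elem S'
    eS' = elem-ren _ eS
    Q : Formula (suc (suc (suc n)))
    Q = app χ (var ∘ suc ∘ swap01) (var zero)
    eQ : Elem Q
    eQ = elem-sub _ eχ
    body : Formula (suc (suc (suc n)))
    body = ren suc φ ⇒ (S' ⇔ Q)
    D : Formula 0
    D = ∀cl body
    eD : Elem D
    eD = elem-∀cl (elem-⇒ (elem-ren suc eφ) (elem-⇔ eS' eQ))
    quiet : All (NoSurface sqcup) (wkN (suc n) R ∷ wkN (suc n) D ∷ [])
    quiet = noSurface-wkN (suc n) (noSurface-Resource _ χ) ∷ elem⇒noSurface (elem-wkN _ eD) ∷ []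
    T : Formula (suc (suc (suc n)))
    T = ren (extR suc) S' [ var zero ]₀
    valid : ⊢T (wk (neg φ) ∷ T ∷ (wk (neg φ) ∨ T) ∷ neg Q ∷ neg (wkN (suc (suc (suc n))) D) ∷ []
                ++ negEqAxioms)
    valid = ⊢T-use body (there (there (there (there (here refl))))) var (sub-id (λ _ → refl) body)
      (⊢T-⇒ (here refl)
        (λ s q → ⊢T-id (elem-ren suc eφ) q (s (there (here (sym (ren-neg suc φ))))))
        (λ s q → ⊢T-⇔ eS' q (s (there (there (here (sym (ren-extR-suc-[var0] S'))))))
          (λ s' q' → ⊢T-id eQ q' (s' (s (there (there (there (there (here refl))))))))))
    givenPrevious : (wkN (suc (suc n)) R ∷ wkN (suc (suc n)) D ∷ []) ◦– (neg φ ∨ wk (⊔ᶠ φS))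
    givenPrevious =
      query [] (wkN (suc (suc n)) D ∷ []) (suc (suc n)) χ swap01 []
        (elem⇒noSurface (elem-wkN _ eD) ∷ []) (∨ₙ (elem⇒noSurface (elem-neg eφ)) (⊔ᶠₙ refl))
        (choose (rightQ (isVar zero) (∨ʳ base))
          (elementary-◦– (eQ ∷ elem-wkN _ eD ∷ [])
            (or (elem-ren suc (elem-neg eφ)) (elem-sub _ (elem-ren _ eS')))
            (or (here refl) valid)))

-- Composition

module Composition (m n : ℕ) (φ : Rep n) (χ : Rep m) (ψ : Fin m → Rep n)
                   (eφ : Elem φ) (eχ : Elem χ) (eψ : ∀ j → Elem (ψ j)) where

  X : Fin n → Term (suc (m + n))
  X i = var (suc (m ↑ʳ i))

  Y : Fin m → Term (suc (m + n))
  Y j = var (suc (j ↑ˡ n))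

  inner : List (Formula (suc (m + n)))
  inner = map (λ j → app (ψ j) X (Y j)) (tabulate id)

  body : Formula (suc (m + n))
  body = conj inner ⇒ (app φ X (var zero) ⇔ app χ Y (var zero))

  D : Formula 0
  D = ∀cl body

  elem-inner : All Elem inner
  elem-inner = map⁺ (tabulate⁺ (λ j → elem-sub _ (eψ j)))

  elem-D : Elem D
  elem-D = elem-∀cl (elem-⇒ (elem-conj elem-inner) (elem-⇔ (elem-sub _ eφ) (elem-sub _ eχ)))

  Resources : ∀ k → List (Fin m) → List (Formula k)
  Resources k js = map (λ j → wkN k (Resource n (ψ j))) js

  Outer : ∀ k → List (Formula k)
  Outer k = wkN k (Resource m χ) ∷ wkN k D ∷ []

  noSurface-Resources : ∀ k js → All (NoSurface sqcup) (Resources k js)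
  noSurface-Resources k js = map⁺ (All.tabulate (λ {j} _ → noSurface-wkN k (noSurface-Resource n (ψ j))))

  noSurface-Outer : ∀ k → All (NoSurface sqcup) (Outer k)
  noSurface-Outer k = noSurface-wkN k (noSurface-Resource m χ) ∷ elem⇒noSurface (elem-wkN k elem-D) ∷ []

  Answered : ∀ {k} → (Fin n → Fin k) → List (Formula k) → Fin m → Set
  Answered {k} ρ As j = Σ (Fin k) λ v → app (ψ j) (var ∘ ρ) (var v) ∈ As

  -- The answers y⃗, x⃗ of the play so far instantiate the variables of D.
  module Final {k} (ρ : Fin n → Fin k) (ys : Fin m → Fin k) where

    σ : Fin (suc (m + n)) → Term (suc k)
    σ zero    = var zero
    σ (suc q) = [ var ∘ suc ∘ ys , var ∘ suc ∘ ρ ]′ (splitAt m q)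

    σ-X : ∀ i → subT σ (X i) ≡ var (suc (ρ i))
    σ-X i = cong [ var ∘ suc ∘ ys , var ∘ suc ∘ ρ ]′ (splitAt-↑ʳ m n i)

    σ-Y : ∀ j → subT σ (Y j) ≡ var (suc (ys j))
    σ-Y j = cong [ var ∘ suc ∘ ys , var ∘ suc ∘ ρ ]′ (splitAt-↑ˡ m j n)

    σ-app : ∀ {a} (θ : Rep a) (Z : Fin a → Term (suc (m + n))) {Z' : Fin a → Fin k} z {z'} →
            (∀ i → subT σ (Z i) ≡ var (suc (Z' i))) → subT σ z ≡ z' →
            sub σ (app θ Z z) ≡ app θ (var ∘ suc ∘ Z') z'
    σ-app θ Z z eZ ez = trans (sub-app σ θ Z z) (sub-cong (λ { zero → ez ; (suc i) → eZ i }) θ)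

    σ-body : sub σ body ≡ (conj (map (sub σ) inner) ⇒
                           (app φ (var ∘ suc ∘ ρ) (var zero) ⇔ app χ (var ∘ suc ∘ ys) (var zero)))
    σ-body = trans (sub-⇒ σ (conj inner) _)
      (cong₂ _⇒_ (sub-conj σ inner)
        (trans (sub-⇔ σ _ _)
          (cong₂ _⇔_ (σ-app φ X (var zero) σ-X refl) (σ-app χ Y (var zero) σ-Y refl))))

    σ-inner : ∀ {B} → B ∈ map (sub σ) inner →
              Σ (Fin m) λ j → B ≡ app (ψ j) (var ∘ suc ∘ ρ) (var (suc (ys j)))
    σ-inner p with ∈-map⁻ (sub σ) p
    ... | _ , q , refl with ∈-map⁻ _ q
    ...   | j , _ , refl = j , σ-app (ψ j) X (Y j) σ-X (σ-Y j)

  finish : ∀ k (ρ : Fin n → Fin k) (As : List (Formula k)) → All Elem As →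
           (answered : ∀ j → Answered ρ As j) →
           (As ++ Outer k) ◦– ⊔ᶠ (ren (extR ρ) φ)
  finish k ρ As eAs answered =
    query As (wkN k D ∷ []) m χ ys (All.map elem⇒noSurface eAs)
      (elem⇒noSurface (elem-wkN k elem-D) ∷ []) (⊔ᶠₙ refl)
      (choose (rightQ (isVar zero) base)
        (elementary-◦– eAs' (elem-sub _ (elem-ren _ (elem-ren _ eφ))) valid))
    where
      ys : Fin m → Fin k
      ys j = proj₁ (answered j)
      open Final ρ ys
      Qχ : Formula (suc k)
      Qχ = app χ (var ∘ suc ∘ ys) (var zero)
      As' : List (Formula (suc k))
      As' = map wk As ++ Qχ ∷ wkN (suc k) D ∷ []
      eAs' : All Elem As'
      eAs' = ++⁺ (map⁺ (All.map (elem-ren suc) eAs)) (elem-sub _ eχ ∷ elem-wkN (suc k) elem-D ∷ [])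
      T : Formula (suc k)
      T = ren (extR suc) (ren (extR ρ) φ) [ var zero ]₀
      Pφ≡T : app φ (var ∘ suc ∘ ρ) (var zero) ≡ T
      Pφ≡T = trans (sub-cong (λ { zero → refl ; (suc i) → refl }) φ)
                   (sym (trans (sub-ren _ _ _) (sub-ren _ _ φ)))
      Γ : List (Formula (suc k))
      Γ = (T ∷ map neg As') ++ negEqAxioms
      neg∈Γ : ∀ {A} → A ∈ As' → neg A ∈ Γ
      neg∈Γ p = there (∈-++⁺ˡ (∈-map⁺ neg p))
      inner-refuted : ∀ {A} → A ∈ map (sub σ) inner → neg A ∈ Γ
      inner-refuted p with σ-inner p
      ... | j , refl = neg∈Γ (∈-++⁺ˡ (subst (_∈ map wk As) (ren-app (ψ j) ρ (ys j))
                                       (∈-map⁺ wk (proj₂ (answered j)))))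
      valid : ⊢T Γ
      valid = ⊢T-use body (neg∈Γ (∈-++⁺ʳ (map wk As) (there (here refl)))) σ σ-body
        (⊢T-⇒ (here refl)
          (λ s q → ⊢T-conj (map⁺ (All.map (elem-sub σ) elem-inner)) q
                     (λ p → s (there (inner-refuted p))))
          (λ s q → ⊢T-⇔ (elem-sub _ eφ) q (s (there (here Pφ≡T)))
            (λ s' q' → ⊢T-id (elem-sub _ eχ) q'
                         (s' (s (there (neg∈Γ (∈-++⁺ʳ (map wk As) (here refl)))))))))

  query-inner : ∀ js k (ρ : Fin n → Fin k) (As : List (Formula k)) → All Elem As →
                (∀ j → j ∈ js ⊎ Answered ρ As j) →
                (As ++ Resources k js ++ Outer k) ◦– ⊔ᶠ (ren (extR ρ) φ)
  query-inner [] k ρ As eAs pending = finish k ρ As eAs answered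
    where
      answered : ∀ j → Answered ρ As j
      answered j with pending j
      ... | inj₁ ()
      ... | inj₂ a = a
  query-inner (j ∷ js) k ρ As eAs pending =
    query As (Resources k js ++ Outer k) n (ψ j) ρ (All.map elem⇒noSurface eAs)
      (++⁺ (noSurface-Resources k js) (noSurface-Outer k)) (⊔ᶠₙ refl)
      (subst₂ _◦–_ rearrange weaken-goal
        (query-inner js (suc k) (suc ∘ ρ) As'
          (++⁺ (map⁺ (All.map (elem-ren suc) eAs)) (elem-sub _ (eψ j) ∷ [])) pending'))
    where
      answer : Formula (suc k)
      answer = app (ψ j) (var ∘ suc ∘ ρ) (var zero)
      As' : List (Formula (suc k))
      As' = map wk As ++ answer ∷ []
      pending' : ∀ j' → j' ∈ js ⊎ Answered (suc ∘ ρ) As' j'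
      pending' j' with pending j'
      ... | inj₁ (here refl) = inj₂ (zero , ∈-++⁺ʳ (map wk As) (here refl))
      ... | inj₁ (there p)   = inj₁ p
      ... | inj₂ (v , p)     =
        inj₂ (suc v , ∈-++⁺ˡ (subst (_∈ map wk As) (ren-app (ψ j') ρ v) (∈-map⁺ wk p)))
      rearrange : As' ++ Resources (suc k) js ++ Outer (suc k) ≡
                  map wk As ++ answer ∷ map wk (Resources k js ++ Outer k)
      rearrange = trans (++-assoc (map wk As) (answer ∷ []) _)
        (cong (λ Z → map wk As ++ answer ∷ Z)
          (sym (trans (map-++ wk (Resources k js) (Outer k))
                      (cong (_++ Outer (suc k)) (sym (map-∘ js))))))
      weaken-goal : ⊔ᶠ (ren (extR (suc ∘ ρ)) φ) ≡ wk (⊔ᶠ (ren (extR ρ) φ))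
      weaken-goal = cong ⊔ᶠ (sym (trans (ren-ren (extR suc) (extR ρ) φ)
                                        (ren-cong (λ { zero → refl ; (suc i) → refl }) φ)))

  computable-comp : (∀ j → CLA7⊢ (Resource n (ψ j))) → CLA7⊢ (Resource m χ) → CLA7⊢ D →
                    CLA7⊢ (⊓cl (⊔ᶠ φ))
  computable-comp resψ resχ def =
    LC Es (⊓cl (⊔ᶠ φ)) provable
      (wait-⊓cl n (⊔ᶠ φ) Es quiet
        (subst₂ _◦–_ weakened ren-id-φ (query-inner (allFin m) n id [] [] (inj₁ ∘ ∈-allFin))))
    where
      Es : List (Formula 0)
      Es = map (λ j → Resource n (ψ j)) (allFin m) ++ Resource m χ ∷ D ∷ []
      quiet : All (NoSurface sqcup) Es
      quiet = ++⁺ (noSurface-Resources 0 (allFin m)) (noSurface-Outer 0)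
      provable : ∀ {E} → E ∈ Es → CLA7⊢ (⊓cl E)
      provable p with ∈-++⁻ (map (λ j → Resource n (ψ j)) (allFin m)) p
      ... | inj₂ (here refl)         = resχ
      ... | inj₂ (there (here refl)) = def
      ... | inj₁ q with ∈-map⁻ _ q
      ...   | j , _ , refl = resψ j
      weakened : Resources n (allFin m) ++ Outer n ≡ map (wkN n) Es
      weakened = sym (trans (map-++ (wkN n) _ (Resource m χ ∷ D ∷ []))
                            (cong (_++ Outer n) (sym (map-∘ (allFin m)))))
      ren-id-φ : ⊔ᶠ (ren (extR id) φ) ≡ ⊔ᶠ φ
      ren-id-φ = cong ⊔ᶠ (trans (ren-as-sub _ φ) (sub-id (λ { zero → refl ; (suc i) → refl }) φ))

AllComputable : ∀ {as} → All Rep as → Set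
AllComputable {as} φs = ∀ {a} (p : a ∈ as) → Computable (All.lookup φs p)

elem-DefEqs : ∀ {as a} (d : Def as a) {φ : Rep a} {φs : All Rep as} → Elem φ →
              (∀ {b} (p : b ∈ as) → Elem (All.lookup φs p)) → All Elem (DefEqs d φ φs)
elem-DefEqs succ              eφ eφs = elem-∀cl {2} (elem-⇔ (elem-sub _ eφ) eq) ∷ []
elem-DefEqs (zer n)           eφ eφs = elem-∀cl {suc n} (elem-⇔ (elem-sub _ eφ) eq) ∷ []
elem-DefEqs (proj n i)        eφ eφs = elem-∀cl {suc n} (elem-⇔ (elem-sub _ eφ) eq) ∷ []
elem-DefEqs (comp {m} {n} h hs) eφ eφs =
  Composition.elem-D m n _ _ _ eφ (eφs h) (λ j → eφs (Vec.lookup hs j)) ∷ []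
elem-DefEqs (prec {n} h h')   eφ eφs =
    elem-∀cl {suc n} (elem-⇔ (elem-sub _ eφ) (elem-sub _ (eφs h)))
  ∷ elem-∀cl {suc (suc (suc n))} (elem-⇒ (elem-sub _ eφ) (elem-⇔ (elem-sub _ eφ) (elem-sub _ (eφs h'))))
  ∷ []

-- x₁ is the innermost free variable of ⊔ᶠ φ, so ind inducts on the first argument.
computable-prec : ∀ {as n} (h : n ∈ as) (h' : suc (suc n) ∈ as) {φ : Rep (suc n)} {φs : All Rep as} →
                  Elem φ → AllComputable φs → All CLA7⊢ (DefEqs (prec h h') φ φs) → CLA7⊢ (⊓cl (⊔ᶠ φ))
computable-prec {n = n} h h' {φ} eφ c (defZero ∷ defSucc ∷ []) =
  ind (⊔ᶠ φ)
    (computable-by-equivalence n n _ _ id (elem-sub _ eφ) (elementary (c h)) (resource (c h))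
      (subst (λ A → CLA7⊢ (∀cl {suc n} (A ⇔ _)))
        (sub-cong (λ { zero → refl ; (suc zero) → refl ; (suc (suc i)) → refl }) φ) defZero))
    (computable-step n φ _ _ eφ (elem-sub _ eφ) (elementary (c h')) (resource (c h'))
      (subst (CLA7⊢ ∘ ∀cl {suc (suc (suc n))})
        (cong₂ _⇒_
          (trans (sub-cong (λ { zero → refl ; (suc zero) → refl ; (suc (suc i)) → refl }) φ)
                 (sym (ren-as-sub suc φ)))
          (cong₂ _⇔_
            (trans (sub-cong (λ { zero → refl ; (suc zero) → refl ; (suc (suc i)) → refl }) φ)
                   (sym (ren-sub (extR suc) _ φ)))
            (sub-cong (λ { zero → refl ; (suc zero) → refl ; (suc (suc zero)) → refl
                         ; (suc (suc (suc i))) → refl }) _)))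
        defSucc))

computable-def : ∀ {as a} (d : Def as a) {φ : Rep a} {φs : All Rep as} →
                 Elem φ → AllComputable φs → All CLA7⊢ (DefEqs d φ φs) → CLA7⊢ (⊓cl (⊔ᶠ φ))
computable-def succ       {φ} eφ c (def ∷ []) = computable-succ φ eφ def
computable-def (zer n)    {φ} eφ c (def ∷ []) = computable-by-term n φ `0 eφ isZero def
computable-def (proj n i) {φ} eφ c (def ∷ []) = computable-by-term n φ (var i) eφ (isVar i) def
computable-def (comp {m} {n} h hs) {φ} eφ c (def ∷ []) =
  Composition.computable-comp m n φ _ _ eφ (elementary (c h)) (elementary ∘ c ∘ Vec.lookup hs)
    (resource ∘ c ∘ Vec.lookup hs) (resource (c h)) def
computable-def (prec h h') {φs = φs} eφ c eqs = computable-prec h h' {φs = φs} eφ c eqs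

standard⇒computable : ∀ {as} (c : Constr as) (φs : All Rep as) → Standard c φs → AllComputable φs
standard⇒computable (c ▷ d) (φ ∷ φs) (st , eφ , _ , eqs) (here refl) = record
  { elementary = eφ
  ; computed   = computable-def d {φ} {φs} eφ earlier
                   (pa⇒cla7-All (elem-DefEqs d {φ} {φs} eφ (elementary ∘ earlier)) eqs)
  }
  where
    earlier : AllComputable φs
    earlier = standard⇒computable c φs st
standard⇒computable (c ▷ d) (φ ∷ φs) (st , _ , _ , _) (there p) = standard⇒computable c φs st p

fact10p1 : {as : List ℕ} (τ : Constr (1 ∷ as)) (φs : All Rep (1 ∷ as)) →
           Standard τ φs → CLA7⊢ (⊓cl (⊔ᶠ (head φs)))
fact10p1 τ (φ ∷ φs) st = computed (standard⇒computable τ (φ ∷ φs) st (here refl))
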